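{- For every $n\ge 0$ and every weak composition $\mu$ of $n$, the linear map $\varphi:\mathcal{L}(\mu)\to \widetilde H^{n-2}((\hat 0,[n]^\mu))$ determined by $\varphi(\wedge(\sigma))=\bar c(\sigma)$ for all $\sigma\in\mathfrak{S}_\mu$ is a well-defined isomorphism of $\mathfrak{S}_n$-modules. In particular $\mathcal{L}(\mu)\cong_{\mathfrak{S}_n}\widetilde H^{n-2}((\hat 0,[n]^\mu))$.
   Context: Let $\mathbf{k}$ be a field of characteristic $\neq2$, $\mathbb{P}$ the positive integers. A colored letter is $x^i=(x,i)\in[n]\times\mathbb{P}$ with color $i$. A weak composition is a sequence $\mu=(\mu(1),\mu(2),\dots)$ of nonnegative integers with $|\mu|=\sum\mu(i)<\infty$; $\mathbf{e}_r$ has a $1$ in position $r$ and $0$ elsewhere; $\mu\le\nu$ means $\mu(i)\le\nu(i)$ for all $i$. A colored permutation of $[n]$ is a word $\sigma=\sigma(1)\cdots\sigma(n)$ of colored letters whose uncolored letters form a permutation of $[n]$; its content counts letters of each color; $\mathfrak{S}_\mu$ is the set of colored permutations of $[|\mu|]$ with content $\mu$. Let $W$ have basis $[n]\times\mathbb{P}$ and let $\Lambda=T(W)/I$ where $I$ is the ideal generated by $x^i\otimes y^i+y^i\otimes x^i$ and $x^i\otimes y^j+y^i\otimes x^j+y^j\otimes x^i+x^j\otimes y^i$ for all $x,y\in[n]$, $i,j\in\mathbb{P}$; write $\wedge(\sigma)=\sigma(1)\wedge\cdots\wedge\sigma(n)$ for the image of $\sigma(1)\otimes\cdots\otimes\sigma(n)$.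 $\mathcal{L}(\mu)$ is the span of $\{\wedge(\sigma):\sigma\in\mathfrak{S}_\mu\}$, an $\mathfrak{S}_n$-module via $\tau\cdot x^i=\tau(x)^i$. The weighted boolean algebra $\mathbb{B}_n^w$ is the poset of weighted subsets $B^\nu$ with $B\subseteq[n]$ and $\nu$ a weak composition with $|\nu|=|B|$, ordered by $A^\nu\le B^\eta$ iff $A\subseteq B$ and $\nu\le\eta$. It has minimum $\hat0=\varnothing^{\mathbf 0}$; $[n]^\mu$ is a maximal element. $\mathfrak{S}_n$ acts by $\tau B^\nu=(\tau B)^\nu$. For $\sigma\in\mathfrak{S}_\mu$, $c(\sigma)$ is the maximal chain of $[\hat0,[n]^\mu]$ whose rank-$i$ element is $\{\sigma(1),\dots,\sigma(i)\}^{\mathbf e_{c_1}+\cdots+\mathbf e_{c_i}}$ where $c_k$ is the color of $\sigma(k)$, and $\bar c(\sigma)=c(\sigma)\setminus\{\hat0,[n]^\mu\}$, a maximal chain of the open interval $(\hat0,[n]^\mu)$. Reduced cohomology is that of the order complex over $\mathbf{k}$; the top cohomology of the pure open interval (whose maximal chains have $n-1$ elements) is the quotient of the $\mathbf{k}$-span of its maximal chains by the image of the coboundary map, and a maximal chain denotes its class there. -}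

module Defs where

open import Level using (_⊔_) renaming (suc to lsuc)
open import Data.Nat using (ℕ; zero; suc; _∸_; _≤_; _≤?_; _≡ᵇ_)
import Data.Nat as ℕ
open import Data.Bool using (Bool; true; false; if_then_else_)
open import Data.Fin using (Fin; toℕ)
import Data.Fin.Properties as FinP
open import Data.Fin.Subset using (Subset; _⊆_; ⊥; ⊤; ⁅_⁆; _∪_; ∣_∣)
open import Data.Fin.Subset.Properties using (_⊆?_)
open import Data.Fin.Permutation using (Permutation′; _⟨$⟩ʳ_; _⟨$⟩ˡ_)
open import Data.List using (List; []; _∷_; _++_; map; foldr; length; filter; take; applyUpTo; removeAt; allFin)
import Data.List.Properties as ListP
open import Data.List.Relation.Unary.All using (All; all?)
open import Data.List.Relation.Unary.Linked using (Linked; linked?)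
open import Data.List.Relation.Binary.Permutation.Propositional using (_↭_)
open import Data.Vec using (Vec; tabulate; zipWith; replicate; fromList; lookup)
import Data.Vec as Vec
import Data.Vec.Properties as VecP
open import Data.Vec.Relation.Binary.Pointwise.Inductive using (Pointwise)
import Data.Vec.Relation.Binary.Pointwise.Inductive as PW
open import Data.Product using (Σ; ∃; _×_; _,_; proj₁; proj₂)
import Data.Product.Properties as ProdP
open import Relation.Nullary using (¬_; Dec; yes; no; ¬?; _×-dec_)
open import Relation.Nullary.Decidable using (⌊_⌋)
open import Relation.Binary.PropositionalEquality using (_≡_; _≢_)
open import Relation.Binary.Definitions using (DecidableEquality)
open import Algebra.Bundles using (CommutativeRing)

record Field c ℓ : Set (lsuc (c ⊔ ℓ)) where
  field
    commutativeRing : CommutativeRing c ℓ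
  open CommutativeRing commutativeRing public
  field
    1≉0 : ¬ (1# ≈ 0#)
    inverse : ∀ x → ¬ (x ≈ 0#) → ∃ λ y → x * y ≈ 1#

-- Weak compositions are given as finite lists μ = (μ(1),…,μ(k));
-- all later entries are 0.  Colours are 0-based: the colour-index i : ℕ
-- stands for the colour i+1 ∈ ℙ, and corresponds to position i of μ.

at : List ℕ → ℕ → ℕ
at []       _       = 0
at (m ∷ _)  zero    = m
at (_ ∷ μ)  (suc j) = at μ j

-- colored letters x^i with x ∈ [n] (as Fin n)
CLetter : ℕ → Set
CLetter n = Fin n × ℕ

-- words = basis elements of the tensor algebra T(W)
Word : ℕ → Set
Word n = List (CLetter n)

word-≟ : ∀ {n} → DecidableEquality (Word n)
word-≟ = ListP.≡-dec (ProdP.≡-dec FinP._≟_ ℕ._≟_)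

IsColPerm : (n : ℕ) → List ℕ → Word n → Set
IsColPerm n μ σ =
  map proj₁ σ ↭ allFin n
  × (∀ (j : ℕ) → length (filter (λ l → proj₂ l ℕ.≟ j) σ) ≡ at μ j)

-- Weighted subsets inside [0̂, [n]^μ]: a weight ν ≤ μ is determined by
-- its first k = length μ entries, so is stored as a Vec ℕ k.

Vertex : ℕ → ℕ → Set
Vertex n k = Subset n × Vec ℕ k

vertex-≟ : ∀ {n k} → DecidableEquality (Vertex n k)
vertex-≟ = ProdP.≡-dec (VecP.≡-dec Data.Bool._≟_) (VecP.≡-dec ℕ._≟_)
  where import Data.Bool

IsWeighted : ∀ {n k} → Vertex n k → Set
IsWeighted (B , ν) = ∣ B ∣ ≡ Vec.sum ν

_≤ᵥ_ : ∀ {n k} → Vertex n k → Vertex n k → Set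
(A , ν) ≤ᵥ (B , η) = A ⊆ B × Pointwise _≤_ ν η

_<ᵥ_ : ∀ {n k} → Vertex n k → Vertex n k → Set
x <ᵥ y = x ≤ᵥ y × x ≢ y

bot : ∀ n k → Vertex n k
bot n k = ⊥ , replicate k 0

top : ∀ n (μ : List ℕ) → Vertex n (length μ)
top n μ = ⊤ , fromList μ

InOpen : ∀ n (μ : List ℕ) → Vertex n (length μ) → Set
InOpen n μ x = IsWeighted x × bot n (length μ) <ᵥ x × x <ᵥ top n μ

Chain : ℕ → List ℕ → Set
Chain n μ = List (Vertex n (length μ))

-- faces of the order complex of (0̂,[n]^μ): chains, listed increasingly
IsChainOI : ∀ n μ → Chain n μ → Set
IsChainOI n μ c = All (InOpen n μ) c × Linked _<ᵥ_ c

IsMaxChainOI : ∀ n μ → Chain n μ → Set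
IsMaxChainOI n μ c = IsChainOI n μ c × length c ≡ n ∸ 1

chain-≟ : ∀ n μ → DecidableEquality (Chain n μ)
chain-≟ _ _ = ListP.≡-dec vertex-≟

≤ᵥ? : ∀ {n k} (x y : Vertex n k) → Dec (x ≤ᵥ y)
≤ᵥ? (A , ν) (B , η) = (A ⊆? B) ×-dec PW.decidable _≤?_ ν η

<ᵥ? : ∀ {n k} (x y : Vertex n k) → Dec (x <ᵥ y)
<ᵥ? x y = ≤ᵥ? x y ×-dec ¬? (vertex-≟ x y)

isChainOI? : ∀ n μ (c : Chain n μ) → Dec (IsChainOI n μ c)
isChainOI? n μ c =
  all? (λ x → (∣ proj₁ x ∣ ℕ.≟ Vec.sum (proj₂ x)) ×-dec (<ᵥ? (bot n (length μ)) x ×-dec <ᵥ? x (top n μ))) c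
  ×-dec linked? <ᵥ? c

unitVec : ∀ k → ℕ → Vec ℕ k
unitVec k r = tabulate (λ j → if toℕ j ≡ᵇ r then 1 else 0)

prefixVertex : ∀ {n} (μ : List ℕ) → Word n → ℕ → Vertex n (length μ)
prefixVertex {n} μ σ i =
  foldr (λ l B → ⁅ proj₁ l ⁆ ∪ B) ⊥ (take i σ) ,
  foldr (λ l ν → zipWith ℕ._+_ (unitVec (length μ) (proj₂ l)) ν) (replicate (length μ) 0) (take i σ)

cbar : ∀ {n} (μ : List ℕ) → Word n → Chain n μ
cbar {n} μ σ = map (prefixVertex μ σ) (applyUpTo suc (n ∸ 1))

actWord : ∀ {n} → Permutation′ n → Word n → Word n
actWord τ σ = map (λ l → (τ ⟨$⟩ʳ proj₁ l) , proj₂ l) σ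

actVertex : ∀ {n k} → Permutation′ n → Vertex n k → Vertex n k
actVertex τ (B , ν) = tabulate (λ y → lookup B (τ ⟨$⟩ˡ y)) , ν

module Lin {c ℓ} (K : Field c ℓ) where
  open Field K

  FormalSum : Set → Set c
  FormalSum B = List (Carrier × B)

  coeff : ∀ {B : Set} → DecidableEquality B → FormalSum B → B → Carrier
  coeff _≟_ []            b = 0#
  coeff _≟_ ((a , x) ∷ s) b = (if ⌊ x ≟ b ⌋ then a else 0#) + coeff _≟_ s b

  lincomb : ∀ {B G : Set} → (G → B → Carrier) → List (Carrier × G) → B → Carrier
  lincomb gen []            b = 0#
  lincomb gen ((a , g) ∷ L) b = a * gen g b + lincomb gen L b

  InSpan : ∀ {B G : Set} → (G → B → Carrier) → (B → Carrier) → Set (c ⊔ ℓ)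
  InSpan {B} {G} gen v = ∃ λ (L : List (Carrier × G)) → ∀ b → v b ≈ lincomb gen L b

  -- the generators of the ideal I, multiplied on both sides by words
  data IGen (n : ℕ) : Set where
    gen₁ : (u v : Word n) (x y : Fin n) (i : ℕ) → IGen n
    gen₂ : (u v : Word n) (x y : Fin n) (i j : ℕ) → IGen n

  igen : ∀ {n} → IGen n → FormalSum (Word n)
  igen (gen₁ u v x y i) =
    (1# , u ++ (x , i) ∷ (y , i) ∷ v) ∷ (1# , u ++ (y , i) ∷ (x , i) ∷ v) ∷ []
  igen (gen₂ u v x y i j) =
    (1# , u ++ (x , i) ∷ (y , j) ∷ v) ∷ (1# , u ++ (y , i) ∷ (x , j) ∷ v) ∷
    (1# , u ++ (y , j) ∷ (x , i) ∷ v) ∷ (1# , u ++ (x , j) ∷ (y , i) ∷ v) ∷ []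

  InI : ∀ {n} → FormalSum (Word n) → Set (c ⊔ ℓ)
  InI {n} t = InSpan {G = IGen n} (λ g → coeff word-≟ (igen g)) (coeff word-≟ t)

  sgn : ℕ → Carrier
  sgn zero    = 1#
  sgn (suc i) = - sgn i

  -- coboundary δ(e_c) evaluated at the chain d:
  -- Σ_i (-1)^i [d with its i-th element removed = c], d a face
  cobdry : ∀ n μ → Chain n μ → Chain n μ → Carrier
  cobdry n μ c d =
    if ⌊ isChainOI? n μ d ⌋
    then foldr (λ i s → (if ⌊ chain-≟ n μ (removeAt d i) c ⌋ then sgn (toℕ i) else 0#) + s) 0# (allFin (length d))
    else 0#

  -- faces of dimension n-3 (chains with n-2 elements)
  Face₋ : ℕ → List ℕ → Set
  Face₋ n μ = Σ (Chain n μ) (λ c → IsChainOI n μ c × length c ℕ.+ 2 ≡ n)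

  -- a top cochain (formal sum of maximal chains) lies in the image of
  -- the coboundary map δ : C^{n-3} → C^{n-2}, i.e. it is 0 in H̃^{n-2}
  InImδ : ∀ n μ → FormalSum (Chain n μ) → Set (c ⊔ ℓ)
  InImδ n μ t = InSpan {G = Face₋ n μ} (λ g → cobdry n μ (proj₁ g)) (coeff (chain-≟ n μ) t)

-- A coloured permutation σ of content μ is a walk from 0̂ to [n]^μ that adds one weighted letter
-- per step, and every maximal chain of [0̂, [n]^μ] is the chain c(σ) of exactly one such σ; so
-- φ is a bijection between the spanning sets, visibly compatible with the 𝔖ₙ-actions.
-- A face of codimension one misses a single rank t + 1, so it determines the prefix u, the
-- suffix v, and the letters x ≠ y with colours a, b added at ranks t + 1 and t + 2. The maximal
-- chains containing it are the c̄ of u x^a y^b v, u y^a x^b v, u y^b x^a v and u x^b y^a v (two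
-- distinct ones when a = b), each with sign (-1)^t in the coboundary. Thus the coboundary of a
-- face is ± a generator of I, and every generator of I supported on 𝔖_μ is a multiple of such a
-- coboundary: the relations of Λ and the image of the coboundary map correspond under φ.

module Submission where

open import Defs
open import Data.Nat using (ℕ)
open import Data.List using (List; []; _∷_; map)
open import Data.Nat.ListAction using (sum)
open import Data.List.Relation.Unary.All using (All)
open import Data.Product using (∃; _×_; _,_; proj₁; proj₂)
open import Data.Fin.Permutation using (Permutation′)
open import Relation.Nullary using (¬_)
open import Relation.Binary.PropositionalEquality using (_≡_)
open import Function.Bundles using (_⇔_; mk⇔)

module Combinatorics where

  open import Algebra.Definitions using (Associative; Commutative)
  open import Data.Bool using (true; false; _∨_; if_then_else_)
  open import Data.Bool.Properties using (∨-zeroʳ; T-≡)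
  open import Data.Empty using () renaming (⊥-elim to contradiction₀)
  open import Data.Fin using (Fin; toℕ; fromℕ<) renaming (zero to fzero; suc to fsuc)
  import Data.Fin.Properties as FinP
  open import Data.Fin.Permutation using (_⟨$⟩ʳ_; _⟨$⟩ˡ_; inverseˡ; inverseʳ)
  open import Data.Fin.Subset as Sub using (Subset; ⁅_⁆; _∪_; ∣_∣)
  import Data.Fin.Subset.Properties as SubP
  open import Data.Nat as ℕ using (ℕ; zero; suc; _+_; _≤_; _<_; z≤n; s≤s; _∸_; _≡ᵇ_)
  import Data.Nat.Properties as NP
  open import Algebra.Properties.CommutativeSemigroup NP.+-commutativeSemigroup using (interchange)
  open import Data.Product using (Σ)
  open import Data.List.Relation.Unary.All as All using ([]; _∷_)
  open import Data.List.Relation.Unary.Linked using (Linked; []; [-]; _∷_)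
  open import Data.List as List using (_++_; length; applyUpTo; removeAt; take; foldr; filter; allFin)
  import Data.List.Properties as ListP
  open import Data.List.Relation.Unary.Any using (here; there)
  open import Data.List.Membership.Propositional using (_∈_)
  import Data.List.Membership.Propositional.Properties as ∈P
  open import Data.List.Membership.Propositional.Properties.WithK using (unique∧set⇒bag)
  open import Data.List.Relation.Unary.Unique.Propositional using (Unique)
  open import Data.List.Relation.Unary.AllPairs using ([]; _∷_)
  import Data.List.Relation.Unary.Unique.Propositional.Properties as UniqueP
  import Data.List.Relation.Unary.Unique.DecPropositional as UniqueDec
  import Data.List.Membership.DecPropositional as ∈Dec
  open import Data.List.Relation.Binary.Permutation.Propositional using (_↭_; ↭-sym; ↭-trans; ↭-refl; swap; ↭⇒↭ₛ)
  import Data.List.Relation.Binary.Permutation.Propositional.Properties as ↭P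
  import Data.List.Relation.Binary.Permutation.Setoid.Properties as ↭ₛP
  open import Data.List.Relation.Binary.BagAndSetEquality using (∼bag⇒↭)
  open import Data.Maybe using (Maybe; just; nothing)
  import Data.Maybe.Properties as MaybeP
  open import Data.Sum using (_⊎_; inj₁; inj₂)
  open import Data.Vec as Vec using (Vec; []; _∷_; lookup; zipWith; replicate; tabulate)
  import Data.Vec.Properties as VecP
  open import Data.Vec.Relation.Binary.Pointwise.Inductive as PW using (Pointwise; []; _∷_)
  open import Function using (_∘_; id)
  open import Function.Bundles using (Equivalence)
  open import Relation.Nullary using (Dec; yes; no; _×-dec_)
  open import Relation.Nullary.Decidable using (⌊_⌋)
  open import Relation.Binary using (tri<; tri≈; tri>)
  open import Relation.Binary.PropositionalEquality
    using (_≢_; refl; sym; trans; cong; cong₂; subst; subst₂; module ≡-Reasoning)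
  import Relation.Binary.PropositionalEquality as ≡

  left-comm : ∀ {a} {A : Set a} {_∙_ : A → A → A} →
              Associative _≡_ _∙_ → Commutative _≡_ _∙_ → ∀ x y z → x ∙ (y ∙ z) ≡ y ∙ (x ∙ z)
  left-comm {_∙_ = _∙_} assoc comm x y z =
    trans (sym (assoc x y z)) (trans (cong (_∙ z) (comm x y)) (assoc y x z))

  lookup-ext : ∀ {a} {A : Set a} {m} {u v : Vec A m} → (∀ i → lookup u i ≡ lookup v i) → u ≡ v
  lookup-ext {u = u} {v} h =
    trans (sym (VecP.tabulate∘lookup u)) (trans (VecP.tabulate-cong h) (VecP.tabulate∘lookup v))

  module _ {n : ℕ} where

    lookup-∪ : ∀ (p q : Subset n) x → lookup (p ∪ q) x ≡ (lookup p x ∨ lookup q x)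
    lookup-∪ p q x = VecP.lookup-zipWith _∨_ x p q

    lookup-⊥ : ∀ x → lookup (Sub.⊥ {n}) x ≡ false
    lookup-⊥ x = VecP.lookup-replicate x false

    lookup-⊤ : ∀ x → lookup (Sub.⊤ {n}) x ≡ true
    lookup-⊤ x = VecP.lookup-replicate x true

    lookup-⁅x⁆-self : ∀ (x : Fin n) → lookup ⁅ x ⁆ x ≡ true
    lookup-⁅x⁆-self x = VecP.[]=⇒lookup (SubP.x∈⁅x⁆ x)

    lookup-⁅x⁆-other : ∀ (x y : Fin n) → x ≢ y → lookup ⁅ x ⁆ y ≡ false
    lookup-⁅x⁆-other x y x≢y with lookup ⁅ x ⁆ y in eq
    ... | false = refl
    ... | true  = contradiction₀ (x≢y (sym (SubP.x∈⁅y⁆⇒x≡y x (VecP.lookup⇒[]= y ⁅ x ⁆ eq))))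

    lookup-⁅x⁆⇒≡ : ∀ (x y : Fin n) → lookup ⁅ x ⁆ y ≡ true → x ≡ y
    lookup-⁅x⁆⇒≡ x y e = sym (SubP.x∈⁅y⁆⇒x≡y x (VecP.lookup⇒[]= y ⁅ x ⁆ e))

    lookup-⁅x⁆∪p-self : ∀ (x : Fin n) p → lookup (⁅ x ⁆ ∪ p) x ≡ true
    lookup-⁅x⁆∪p-self x p = trans (lookup-∪ ⁅ x ⁆ p x) (cong (_∨ lookup p x) (lookup-⁅x⁆-self x))

    lookup-p⇒lookup-⁅x⁆∪p : ∀ (x : Fin n) p y → lookup p y ≡ true → lookup (⁅ x ⁆ ∪ p) y ≡ true
    lookup-p⇒lookup-⁅x⁆∪p x p y e = trans (lookup-∪ ⁅ x ⁆ p y) (trans (cong (lookup ⁅ x ⁆ y ∨_) e) (∨-zeroʳ _))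

    lookup-⁅x⁆∪p⁻ : ∀ (x : Fin n) p y → lookup (⁅ x ⁆ ∪ p) y ≡ true → x ≡ y ⊎ lookup p y ≡ true
    lookup-⁅x⁆∪p⁻ x p y e with lookup ⁅ x ⁆ y in ex | lookup p y | trans (sym (lookup-∪ ⁅ x ⁆ p y)) e
    ... | true  | _    | _ = inj₁ (lookup-⁅x⁆⇒≡ x y ex)
    ... | false | true | _ = inj₂ refl

    lookup-⁅x⁆∪p-fresh : ∀ (x : Fin n) p y → x ≢ y → lookup p y ≡ false → lookup (⁅ x ⁆ ∪ p) y ≡ false
    lookup-⁅x⁆∪p-fresh x p y x≢y e = trans (lookup-∪ ⁅ x ⁆ p y) (cong₂ _∨_ (lookup-⁅x⁆-other x y x≢y) e)

    ⊆⇒lookup : ∀ {p q : Subset n} → p Sub.⊆ q → ∀ x → lookup p x ≡ true → lookup q x ≡ true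
    ⊆⇒lookup p⊆q x e = VecP.[]=⇒lookup (p⊆q (VecP.lookup⇒[]= x _ e))

    lookup⇒⊆ : ∀ {p q : Subset n} → (∀ x → lookup p x ≡ true → lookup q x ≡ true) → p Sub.⊆ q
    lookup⇒⊆ h {x} x∈p = VecP.lookup⇒[]= x _ (h x (VecP.[]=⇒lookup x∈p))


  ∣⁅x⁆∪p∣ : ∀ {n} (x : Fin n) p → lookup p x ≡ false → ∣ ⁅ x ⁆ ∪ p ∣ ≡ suc ∣ p ∣
  ∣⁅x⁆∪p∣ fzero    (false ∷ p) _ = cong (suc ∘ ∣_∣) (SubP.∪-identityˡ p)
  ∣⁅x⁆∪p∣ (fsuc x) (false ∷ p) e = ∣⁅x⁆∪p∣ x p e
  ∣⁅x⁆∪p∣ (fsuc x) (true ∷ p)  e = cong suc (∣⁅x⁆∪p∣ x p e)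

  ⊆∧∣q∣≤∣p∣⇒≡ : ∀ {n} {p q : Subset n} → p Sub.⊆ q → ∣ q ∣ ≤ ∣ p ∣ → p ≡ q
  ⊆∧∣q∣≤∣p∣⇒≡ {p = []}        {[]}        _ _ = refl
  ⊆∧∣q∣≤∣p∣⇒≡ {p = true ∷ p}  {true ∷ q}  h (s≤s c) = cong (true ∷_) (⊆∧∣q∣≤∣p∣⇒≡ (SubP.drop-∷-⊆ h) c)
  ⊆∧∣q∣≤∣p∣⇒≡ {p = true ∷ p}  {false ∷ q} h c with h Vec.here
  ... | ()
  ⊆∧∣q∣≤∣p∣⇒≡ {p = false ∷ p} {true ∷ q}  h c =
    contradiction₀ (NP.<-irrefl refl (NP.≤-trans (s≤s (SubP.p⊆q⇒∣p∣≤∣q∣ (SubP.drop-∷-⊆ h))) c))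
  ⊆∧∣q∣≤∣p∣⇒≡ {p = false ∷ p} {false ∷ q} h c = cong (false ∷_) (⊆∧∣q∣≤∣p∣⇒≡ (SubP.drop-∷-⊆ h) c)

  ∣p∣<∣q∣⇒∃[q─p] : ∀ {n} (p q : Subset n) → ∣ p ∣ < ∣ q ∣ → ∃ λ x → lookup q x ≡ true × lookup p x ≡ false
  ∣p∣<∣q∣⇒∃[q─p] (false ∷ p) (true ∷ q)  _ = fzero , refl , refl
  ∣p∣<∣q∣⇒∃[q─p] (true ∷ p)  (true ∷ q)  c with ∣p∣<∣q∣⇒∃[q─p] p q (NP.≤-pred c)
  ... | x , x∈q , x∉p = fsuc x , x∈q , x∉p
  ∣p∣<∣q∣⇒∃[q─p] (true ∷ p)  (false ∷ q) c with ∣p∣<∣q∣⇒∃[q─p] p q (NP.<-trans (NP.n<1+n _) c)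
  ... | x , x∈q , x∉p = fsuc x , x∈q , x∉p
  ∣p∣<∣q∣⇒∃[q─p] (false ∷ p) (false ∷ q) c with ∣p∣<∣q∣⇒∃[q─p] p q c
  ... | x , x∈q , x∉p = fsuc x , x∈q , x∉p

  _≤ʷ_ : ∀ {k} → Vec ℕ k → Vec ℕ k → Set
  _≤ʷ_ = Pointwise _≤_

  sum-mono-≤ʷ : ∀ {k} {u v : Vec ℕ k} → u ≤ʷ v → Vec.sum u ≤ Vec.sum v
  sum-mono-≤ʷ []       = z≤n
  sum-mono-≤ʷ (p ∷ ps) = NP.+-mono-≤ p (sum-mono-≤ʷ ps)

  ≤ʷ∧sum≤⇒≡ : ∀ {k} {u v : Vec ℕ k} → u ≤ʷ v → Vec.sum v ≤ Vec.sum u → u ≡ v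
  ≤ʷ∧sum≤⇒≡ [] _ = refl
  ≤ʷ∧sum≤⇒≡ {u = a ∷ u} (p ∷ ps) s with NP.m≤n⇒m<n∨m≡n p
  ... | inj₂ refl = cong (a ∷_) (≤ʷ∧sum≤⇒≡ ps (NP.+-cancelˡ-≤ a _ _ s))
  ... | inj₁ lt   = contradiction₀ (NP.<-irrefl refl (NP.≤-trans (NP.+-mono-<-≤ lt (sum-mono-≤ʷ ps)) s))

  ≤ʷ∧sum<⇒∃< : ∀ {k} {u v : Vec ℕ k} → u ≤ʷ v → Vec.sum u < Vec.sum v → ∃ λ c → lookup u c < lookup v c
  ≤ʷ∧sum<⇒∃< {u = a ∷ u} (p ∷ ps) s with NP.m≤n⇒m<n∨m≡n p
  ... | inj₁ lt   = fzero , lt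
  ... | inj₂ refl with ≤ʷ∧sum<⇒∃< ps (NP.+-cancelˡ-< a _ _ s)
  ...   | c , lt = fsuc c , lt

  ≤ʷ-tabulate : ∀ {k} {u v : Vec ℕ k} → (∀ c → lookup u c ≤ lookup v c) → u ≤ʷ v
  ≤ʷ-tabulate {u = []}    {[]}    h = []
  ≤ʷ-tabulate {u = a ∷ u} {b ∷ v} h = h fzero ∷ ≤ʷ-tabulate (h ∘ fsuc)

  sum-zipWith-+ : ∀ {k} (u v : Vec ℕ k) → Vec.sum (zipWith _+_ u v) ≡ Vec.sum u + Vec.sum v
  sum-zipWith-+ []      []      = refl
  sum-zipWith-+ (a ∷ u) (b ∷ v) =
    trans (cong (a + b +_) (sum-zipWith-+ u v)) (interchange a b (Vec.sum u) (Vec.sum v))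

  sum-replicate-0 : ∀ k → Vec.sum (replicate k 0) ≡ 0
  sum-replicate-0 zero    = refl
  sum-replicate-0 (suc k) = sum-replicate-0 k

  lookup-zipWith-+ : ∀ {k} (u v : Vec ℕ k) j → lookup (zipWith _+_ u v) j ≡ lookup u j + lookup v j
  lookup-zipWith-+ u v j = VecP.lookup-zipWith _+_ j u v

  module _ (k : ℕ) where

    lookup-unitVec : ∀ r (j : Fin k) → lookup (unitVec k r) j ≡ (if toℕ j ≡ᵇ r then 1 else 0)
    lookup-unitVec r j = VecP.lookup∘tabulate _ j

    lookup-unitVec-self : ∀ (c : Fin k) → lookup (unitVec k (toℕ c)) c ≡ 1
    lookup-unitVec-self c =
      trans (lookup-unitVec (toℕ c) c) (cong (if_then 1 else 0) (Equivalence.to T-≡ (NP.≡⇒≡ᵇ (toℕ c) (toℕ c) refl)))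

    lookup-unitVec-other : ∀ r (j : Fin k) → toℕ j ≢ r → lookup (unitVec k r) j ≡ 0
    lookup-unitVec-other r j ne rewrite lookup-unitVec r j with toℕ j ≡ᵇ r in eq
    ... | false = refl
    ... | true  = contradiction₀ (ne (NP.≡ᵇ⇒≡ (toℕ j) r (Equivalence.from T-≡ eq)))

    lookup-unitVec-< : ∀ {r} (r<k : r < k) → lookup (unitVec k r) (fromℕ< r<k) ≡ 1
    lookup-unitVec-< r<k = subst (λ r → lookup (unitVec k r) (fromℕ< r<k) ≡ 1) (FinP.toℕ-fromℕ< r<k) (lookup-unitVec-self (fromℕ< r<k))

    lookup-unitVec≡1⇒ : ∀ r (j : Fin k) → lookup (unitVec k r) j ≡ 1 → toℕ j ≡ r
    lookup-unitVec≡1⇒ r j e with toℕ j ℕ.≟ r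
    ... | yes j≡r = j≡r
    ... | no  j≢r = contradiction₀ (NP.0≢1+n (trans (sym (lookup-unitVec-other r j j≢r)) e))

    private
      u : ℕ → Fin k → ℕ
      u r j = lookup (unitVec k r) j

    unitVec-injective : ∀ {c d} → c < k → (∀ j → u c j ≡ u d j) → c ≡ d
    unitVec-injective c<k h = trans (sym (FinP.toℕ-fromℕ< c<k)) (lookup-unitVec≡1⇒ _ _ (trans (sym (h _)) (lookup-unitVec-< c<k)))

    unitVec-pair-cancel : ∀ {a b c₁ c₂} → c₁ < k → c₂ < k →
      (∀ j → lookup (unitVec k c₂) j + lookup (unitVec k c₁) j ≡ lookup (unitVec k b) j + lookup (unitVec k a) j) →
      (c₁ ≡ a × c₂ ≡ b) ⊎ (c₁ ≡ b × c₂ ≡ a)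
    unitVec-pair-cancel {a} {b} {c₁} {c₂} c₁<k c₂<k e with c₁ ℕ.≟ a | c₁ ℕ.≟ b
    ... | yes refl | _ = inj₁ (refl , unitVec-injective c₂<k (λ j → NP.+-cancelʳ-≡ (u a j) _ _ (e j)))
    ... | no _ | yes refl = inj₂ (refl , unitVec-injective c₂<k (λ j → NP.+-cancelˡ-≡ (u b j) _ _ (trans (NP.+-comm (u b j) _) (e j))))
    ... | no c₁≢a | no c₁≢b = contradiction₀ (NP.1+n≢0 (begin
      suc (u c₂ j₁)        ≡⟨ NP.+-comm 1 _ ⟩
      u c₂ j₁ + 1          ≡⟨ cong (u c₂ j₁ +_) (sym (lookup-unitVec-< c₁<k)) ⟩
      u c₂ j₁ + u c₁ j₁    ≡⟨ e j₁ ⟩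
      u b j₁ + u a j₁      ≡⟨ cong₂ _+_ (lookup-unitVec-other b j₁ (c₁≢b ∘ c₁≡))
                                        (lookup-unitVec-other a j₁ (c₁≢a ∘ c₁≡)) ⟩
      0                    ∎))
      where
      open ≡-Reasoning
      j₁ : Fin k
      j₁ = fromℕ< c₁<k
      c₁≡ : ∀ {r} → toℕ j₁ ≡ r → c₁ ≡ r
      c₁≡ = trans (sym (FinP.toℕ-fromℕ< c₁<k))

  sum-unitVec : ∀ k (c : Fin k) → Vec.sum (unitVec k (toℕ c)) ≡ 1
  sum-unitVec (suc k) fzero    = cong suc (sum-zeros k)
    where
    sum-zeros : ∀ k → Vec.sum (tabulate {n = k} (λ j → if suc (toℕ j) ≡ᵇ 0 then 1 else 0)) ≡ 0
    sum-zeros zero    = refl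
    sum-zeros (suc k) = sum-zeros k
  sum-unitVec (suc k) (fsuc c) = sum-unitVec k c

  -- The adjacent pairs x^a y^b, y^a x^b, y^b x^a, x^b y^a of the four words in a generator of I.
  data Reordering {n} (x y : Fin n) (a b : ℕ) : CLetter n → CLetter n → Set where
    ⟨xa,yb⟩ : Reordering x y a b (x , a) (y , b)
    ⟨ya,xb⟩ : Reordering x y a b (y , a) (x , b)
    ⟨yb,xa⟩ : Reordering x y a b (y , b) (x , a)
    ⟨xb,ya⟩ : Reordering x y a b (x , b) (y , a)

  module Vertices (n k : ℕ) where

    V : Set
    V = Vertex n k

    rank : V → ℕ
    rank v = ∣ proj₁ v ∣

    extend : CLetter n → V → V
    extend (x , c) (p , ν) = ⁅ x ⁆ ∪ p , zipWith _+_ (unitVec k c) ν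

    Fresh : CLetter n → V → Set
    Fresh (x , c) (p , ν) = lookup p x ≡ false × c < k

    extend-comm : ∀ l l′ v → extend l (extend l′ v) ≡ extend l′ (extend l v)
    extend-comm (x , a) (y , b) (p , ν) = cong₂ _,_
      (left-comm (SubP.∪-assoc {n}) SubP.∪-comm ⁅ x ⁆ ⁅ y ⁆ p)
      (left-comm (VecP.zipWith-assoc NP.+-assoc) (VecP.zipWith-comm NP.+-comm) (unitVec k a) (unitVec k b) ν)

    extend-swap-letters : ∀ x y a b v → extend (x , a) (extend (y , b) v) ≡ extend (y , a) (extend (x , b) v)
    extend-swap-letters x y a b (p , ν) = cong (_, _) (cong proj₁ (extend-comm (x , a) (y , b) (p , ν)))

    extend-swap-colours : ∀ x y a b v → extend (x , a) (extend (y , b) v) ≡ extend (x , b) (extend (y , a) v)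
    extend-swap-colours x y a b (p , ν) = cong (_ ,_) (cong proj₂ (extend-comm (x , a) (y , b) (p , ν)))

    ≤ᵥ-trans : ∀ {u v w : V} → u ≤ᵥ v → v ≤ᵥ w → u ≤ᵥ w
    ≤ᵥ-trans (p , q) (p′ , q′) = SubP.⊆-trans p p′ , PW.trans NP.≤-trans q q′

    ≤ᵥ-antisym : ∀ {u v : V} → u ≤ᵥ v → v ≤ᵥ u → u ≡ v
    ≤ᵥ-antisym (p , q) (p′ , q′) = cong₂ _,_ (SubP.⊆-antisym p p′) (≤ʷ∧sum≤⇒≡ q (sum-mono-≤ʷ q′))

    <ᵥ-trans : ∀ {u v w : V} → u <ᵥ v → v <ᵥ w → u <ᵥ w
    <ᵥ-trans (u≤v , u≢v) (v≤w , _) = ≤ᵥ-trans u≤v v≤w , λ { refl → u≢v (≤ᵥ-antisym u≤v v≤w) }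

    rank-mono : ∀ {u v : V} → u ≤ᵥ v → rank u ≤ rank v
    rank-mono (p , _) = SubP.p⊆q⇒∣p∣≤∣q∣ p

    rank-strict : ∀ {u v : V} → u <ᵥ v → IsWeighted u → IsWeighted v → rank u < rank v
    rank-strict {u} {v} (u≤v@(p , q) , u≢v) wu wv with NP.m≤n⇒m<n∨m≡n (rank-mono u≤v)
    ... | inj₁ lt = lt
    ... | inj₂ e  = contradiction₀ (u≢v (cong₂ _,_
          (⊆∧∣q∣≤∣p∣⇒≡ p (NP.≤-reflexive (sym e)))
          (≤ʷ∧sum≤⇒≡ q (NP.≤-reflexive (trans (sym wv) (trans (sym e) wu))))))

    rank-≢⇒≢ : ∀ {u v : V} → rank u ≢ rank v → u ≢ v
    rank-≢⇒≢ ne refl = ne refl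

    rank-extend : ∀ l v → Fresh l v → rank (extend l v) ≡ suc (rank v)
    rank-extend (x , c) (p , ν) (x∉p , _) = ∣⁅x⁆∪p∣ x p x∉p

    sum-unitVec< : ∀ {c} → c < k → Vec.sum (unitVec k c) ≡ 1
    sum-unitVec< c<k = subst (λ r → Vec.sum (unitVec k r) ≡ 1) (FinP.toℕ-fromℕ< c<k) (sum-unitVec k (fromℕ< c<k))

    IsWeighted-extend : ∀ l v → Fresh l v → IsWeighted v → IsWeighted (extend l v)
    IsWeighted-extend (x , c) (p , ν) fresh@(_ , c<k) w = begin
      rank (extend (x , c) (p , ν))          ≡⟨ rank-extend (x , c) (p , ν) fresh ⟩
      suc ∣ p ∣                              ≡⟨ cong suc w ⟩
      1 + Vec.sum ν                          ≡⟨ cong (_+ Vec.sum ν) (sym (sum-unitVec< c<k)) ⟩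
      Vec.sum (unitVec k c) + Vec.sum ν      ≡⟨ sym (sum-zipWith-+ (unitVec k c) ν) ⟩
      Vec.sum (zipWith _+_ (unitVec k c) ν)  ∎
      where open ≡-Reasoning

    ≤ᵥ∧rank≤⇒≡ : ∀ {u v : V} → u ≤ᵥ v → IsWeighted u → IsWeighted v → rank v ≤ rank u → u ≡ v
    ≤ᵥ∧rank≤⇒≡ {u} {v} u≤v wu wv r with vertex-≟ u v
    ... | yes u≡v = u≡v
    ... | no  u≢v = contradiction₀ (NP.<-irrefl refl (NP.<-≤-trans (rank-strict (u≤v , u≢v) wu wv) r))

    ≤ᵥ-extend : ∀ l v → v ≤ᵥ extend l v
    ≤ᵥ-extend (x , c) (p , ν) =
      SubP.q⊆p∪q ⁅ x ⁆ p ,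
      ≤ʷ-tabulate λ j → subst (lookup ν j ≤_) (sym (lookup-zipWith-+ (unitVec k c) ν j)) (NP.m≤n+m _ _)

    <ᵥ-extend : ∀ l v → Fresh l v → v <ᵥ extend l v
    <ᵥ-extend l v fresh = ≤ᵥ-extend l v , rank-≢⇒≢ (λ e → NP.1+n≢n (sym (trans e (rank-extend l v fresh))))

    extend-≤ᵥ : ∀ x (c : Fin k) (u w : V) → u ≤ᵥ w → lookup (proj₁ w) x ≡ true →
                lookup (proj₂ u) c < lookup (proj₂ w) c → extend (x , toℕ c) u ≤ᵥ w
    extend-≤ᵥ x c (p , ν) (q , η) (p⊆q , ν≤η) x∈q νc<ηc = lookup⇒⊆ set≤ , ≤ʷ-tabulate wt≤
      where
      set≤ : ∀ z → lookup (⁅ x ⁆ ∪ p) z ≡ true → lookup q z ≡ true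
      set≤ z e with lookup-⁅x⁆∪p⁻ x p z e
      ... | inj₁ refl = x∈q
      ... | inj₂ z∈p  = ⊆⇒lookup p⊆q z z∈p
      wt≤ : ∀ j → lookup (zipWith _+_ (unitVec k (toℕ c)) ν) j ≤ lookup η j
      wt≤ j rewrite lookup-zipWith-+ (unitVec k (toℕ c)) ν j with c FinP.≟ j
      ... | yes refl rewrite lookup-unitVec-self k c = νc<ηc
      ... | no c≢j rewrite lookup-unitVec-other k (toℕ c) j (c≢j ∘ sym ∘ FinP.toℕ-injective) = PW.lookup ν≤η j

    -- A new element of w and a colour whose multiplicity grows give a letter extending u inside w.
    extend-below : ∀ (u w : V) → u ≤ᵥ w → IsWeighted u → IsWeighted w → rank u < rank w →
                   Σ (CLetter n) λ l → Fresh l u × extend l u ≤ᵥ w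
    extend-below (p , ν) (q , η) u≤w@(_ , ν≤η) wu ww r
      with ∣p∣<∣q∣⇒∃[q─p] p q r | ≤ʷ∧sum<⇒∃< ν≤η (subst₂ _<_ wu ww r)
    ... | x , x∈q , x∉p | c , νc<ηc =
      (x , toℕ c) , (x∉p , FinP.toℕ<n c) , extend-≤ᵥ x c (p , ν) (q , η) u≤w x∈q νc<ηc

    cover⇒extend : ∀ (u w : V) → u ≤ᵥ w → IsWeighted u → IsWeighted w → rank w ≡ suc (rank u) →
                   Σ (CLetter n) λ l → Fresh l u × w ≡ extend l u
    cover⇒extend u w u≤w wu ww r with extend-below u w u≤w wu ww (NP.≤-reflexive (sym r))
    ... | l , fresh , lu≤w = l , fresh , sym (≤ᵥ∧rank≤⇒≡ lu≤w (IsWeighted-extend l u fresh wu) ww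
                                                (NP.≤-reflexive (trans r (sym (rank-extend l u fresh)))))

    interpolate : ∀ (u w : V) → u ≤ᵥ w → IsWeighted u → IsWeighted w → rank w ≡ suc (suc (rank u)) →
                  Σ V λ m → u <ᵥ m × m <ᵥ w × IsWeighted m
    interpolate u w u≤w wu ww r with extend-below u w u≤w wu ww (NP.≤-trans (NP.n≤1+n _) (NP.≤-reflexive (sym r)))
    ... | l , fresh , lu≤w =
      extend l u , <ᵥ-extend l u fresh ,
      (lu≤w , rank-≢⇒≢ (λ e → NP.1+n≢n (sym (trans (sym (rank-extend l u fresh)) (trans e r))))) ,
      IsWeighted-extend l u fresh wu

    extend-injective : ∀ l l′ v → Fresh l v → Fresh l′ v → extend l v ≡ extend l′ v → l ≡ l′
    extend-injective (x , c) (x′ , c′) (p , ν) (x∉p , c<k) _ e = cong₂ _,_ x≡x′ c≡c′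
      where
      x≡x′ : x ≡ x′
      x≡x′ with lookup-⁅x⁆∪p⁻ x′ p x (trans (sym (cong (λ q → lookup (proj₁ q) x) e)) (lookup-⁅x⁆∪p-self x p))
      ... | inj₁ x′≡x = sym x′≡x
      ... | inj₂ x∈p with trans (sym x∉p) x∈p
      ...   | ()
      c≡c′ : c ≡ c′
      c≡c′ = unitVec-injective k c<k λ j → NP.+-cancelʳ-≡ (lookup ν j) _ _
        (trans (sym (lookup-zipWith-+ (unitVec k c) ν j))
          (trans (cong (λ q → lookup (proj₂ q) j) e) (lookup-zipWith-+ (unitVec k c′) ν j)))

    extend²-Reordering : ∀ {x y a b l₁ l₂} → Reordering x y a b l₁ l₂ → ∀ v →
                         extend l₂ (extend l₁ v) ≡ extend (y , b) (extend (x , a) v)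
    extend²-Reordering ⟨xa,yb⟩ v = refl
    extend²-Reordering ⟨ya,xb⟩ v = extend-swap-letters _ _ _ _ v
    extend²-Reordering ⟨yb,xa⟩ v = extend-comm _ _ v
    extend²-Reordering ⟨xb,ya⟩ v = extend-swap-colours _ _ _ _ v

    private
      two-new-elements : ∀ {p : Subset n} {x y z₁ z₂} → lookup p z₁ ≡ false → lookup (⁅ z₁ ⁆ ∪ p) z₂ ≡ false →
        ⁅ z₂ ⁆ ∪ (⁅ z₁ ⁆ ∪ p) ≡ ⁅ y ⁆ ∪ (⁅ x ⁆ ∪ p) → (z₁ ≡ x × z₂ ≡ y) ⊎ (z₁ ≡ y × z₂ ≡ x)
      two-new-elements {p} {x} {y} {z₁} {z₂} z₁∉p z₂∉z₁p e with in-xyp z₁ z₁∉p z₁∈ | in-xyp z₂ z₂∉p z₂∈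
        where
        in-xyp : ∀ z → lookup p z ≡ false → lookup (⁅ y ⁆ ∪ (⁅ x ⁆ ∪ p)) z ≡ true → y ≡ z ⊎ x ≡ z
        in-xyp z z∉p z∈ with lookup-⁅x⁆∪p⁻ y _ z z∈
        ... | inj₁ y≡z = inj₁ y≡z
        ... | inj₂ z∈xp with lookup-⁅x⁆∪p⁻ x p z z∈xp
        ...   | inj₁ x≡z = inj₂ x≡z
        ...   | inj₂ z∈p with trans (sym z∉p) z∈p
        ...     | ()
        z₁∈ : lookup (⁅ y ⁆ ∪ (⁅ x ⁆ ∪ p)) z₁ ≡ true
        z₁∈ = subst (λ q → lookup q z₁ ≡ true) e (lookup-p⇒lookup-⁅x⁆∪p z₂ _ z₁ (lookup-⁅x⁆∪p-self z₁ p))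
        z₂∈ : lookup (⁅ y ⁆ ∪ (⁅ x ⁆ ∪ p)) z₂ ≡ true
        z₂∈ = subst (λ q → lookup q z₂ ≡ true) e (lookup-⁅x⁆∪p-self z₂ _)
        z₂∉p : lookup p z₂ ≡ false
        z₂∉p with lookup ⁅ z₁ ⁆ z₂ | trans (sym (lookup-∪ ⁅ z₁ ⁆ p z₂)) z₂∉z₁p
        ... | false | e′ = e′
      ... | inj₁ refl | inj₂ refl = inj₂ (refl , refl)
      ... | inj₂ refl | inj₁ refl = inj₁ (refl , refl)
      ... | inj₁ refl | inj₁ refl with trans (sym (lookup-⁅x⁆∪p-self z₁ p)) z₂∉z₁p
      ...   | ()
      two-new-elements {p} {z₁ = z₁} z₁∉p z₂∉z₁p e | inj₂ refl | inj₂ refl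
        with trans (sym (lookup-⁅x⁆∪p-self z₁ p)) z₂∉z₁p
      ...   | ()

    extend²≡⇒Reordering : ∀ v {l₁ l₂ x y a b} → Fresh l₁ v → Fresh l₂ (extend l₁ v) →
      extend l₂ (extend l₁ v) ≡ extend (y , b) (extend (x , a) v) → Reordering x y a b l₁ l₂
    extend²≡⇒Reordering (p , ν) {z₁ , c₁} {z₂ , c₂} {x} {y} {a} {b} (z₁∉p , c₁<k) (z₂∉z₁p , c₂<k) e =
      reordering (two-new-elements z₁∉p z₂∉z₁p (cong proj₁ e)) (unitVec-pair-cancel k c₁<k c₂<k colours)
      where
      colours : ∀ j → lookup (unitVec k c₂) j + lookup (unitVec k c₁) j ≡ lookup (unitVec k b) j + lookup (unitVec k a) j
      colours j = NP.+-cancelʳ-≡ (lookup ν j) _ _ (begin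
        lookup (unitVec k c₂) j + lookup (unitVec k c₁) j + lookup ν j
          ≡⟨ NP.+-assoc (lookup (unitVec k c₂) j) _ _ ⟩
        lookup (unitVec k c₂) j + (lookup (unitVec k c₁) j + lookup ν j)
          ≡⟨ weight-at (z₁ , c₁) (z₂ , c₂) ⟨
        lookup (proj₂ (extend (z₂ , c₂) (extend (z₁ , c₁) (p , ν)))) j
          ≡⟨ cong (λ w → lookup (proj₂ w) j) e ⟩
        lookup (proj₂ (extend (y , b) (extend (x , a) (p , ν)))) j
          ≡⟨ weight-at (x , a) (y , b) ⟩
        lookup (unitVec k b) j + (lookup (unitVec k a) j + lookup ν j)
          ≡⟨ NP.+-assoc (lookup (unitVec k b) j) _ _ ⟨
        lookup (unitVec k b) j + lookup (unitVec k a) j + lookup ν j ∎)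
        where
        open ≡-Reasoning
        weight-at : ∀ l₁ l₂ → lookup (proj₂ (extend l₂ (extend l₁ (p , ν)))) j
                              ≡ lookup (unitVec k (proj₂ l₂)) j + (lookup (unitVec k (proj₂ l₁)) j + lookup ν j)
        weight-at (_ , d₁) (_ , d₂) =
          trans (lookup-zipWith-+ (unitVec k d₂) _ j) (cong (lookup (unitVec k d₂) j +_) (lookup-zipWith-+ (unitVec k d₁) ν j))
      reordering : (z₁ ≡ x × z₂ ≡ y) ⊎ (z₁ ≡ y × z₂ ≡ x) → (c₁ ≡ a × c₂ ≡ b) ⊎ (c₁ ≡ b × c₂ ≡ a) →
                   Reordering x y a b (z₁ , c₁) (z₂ , c₂)
      reordering (inj₁ (refl , refl)) (inj₁ (refl , refl)) = ⟨xa,yb⟩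
      reordering (inj₁ (refl , refl)) (inj₂ (refl , refl)) = ⟨xb,ya⟩
      reordering (inj₂ (refl , refl)) (inj₁ (refl , refl)) = ⟨ya,xb⟩
      reordering (inj₂ (refl , refl)) (inj₂ (refl , refl)) = ⟨yb,xa⟩

  data Position (t : ℕ) : ℕ → Set where
    before : ∀ {p} → p < t → Position t p
    first  : Position t t
    second : Position t (suc t)
    after  : ∀ q → Position t (suc (suc (t + q)))

  position : ∀ t p → Position t p
  position zero    zero          = first
  position zero    (suc zero)    = second
  position zero    (suc (suc q)) = after q
  position (suc t) zero          = before (s≤s z≤n)
  position (suc t) (suc p) with position t p
  ... | before lt = before (s≤s lt)
  ... | first     = first
  ... | second    = second
  ... | after q   = after q

  module _ {a} {A : Set a} where

    -- ℕ-indexed lookup and removal: out of range, nth gives nothing and deleteAt removes nothing.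
    nth : List A → ℕ → Maybe A
    nth []       _       = nothing
    nth (x ∷ xs) zero    = just x
    nth (x ∷ xs) (suc p) = nth xs p

    deleteAt : List A → ℕ → List A
    deleteAt []       _       = []
    deleteAt (x ∷ xs) zero    = xs
    deleteAt (x ∷ xs) (suc i) = x ∷ deleteAt xs i

    nth-ext : ∀ {xs ys : List A} → (∀ p → nth xs p ≡ nth ys p) → xs ≡ ys
    nth-ext {[]}     {[]}     h = refl
    nth-ext {[]}     {y ∷ ys} h with h 0
    ... | ()
    nth-ext {x ∷ xs} {[]}     h with h 0
    ... | ()
    nth-ext {x ∷ xs} {y ∷ ys} h with h 0
    ... | refl = cong (x ∷_) (nth-ext (h ∘ suc))

    nth-≥length : ∀ (xs : List A) p → length xs ≤ p → nth xs p ≡ nothing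
    nth-≥length []       p       _        = refl
    nth-≥length (x ∷ xs) (suc p) (s≤s le) = nth-≥length xs p le

    nth-<length : ∀ (xs : List A) p → p < length xs → Σ A λ y → nth xs p ≡ just y
    nth-<length (x ∷ xs) zero    _        = x , refl
    nth-<length (x ∷ xs) (suc p) (s≤s lt) = nth-<length xs p lt

    nth-just⇒<length : ∀ (xs : List A) p {y} → nth xs p ≡ just y → p < length xs
    nth-just⇒<length (x ∷ xs) zero    e = s≤s z≤n
    nth-just⇒<length (x ∷ xs) (suc p) e = s≤s (nth-just⇒<length xs p e)

    removeAt≡deleteAt : ∀ (xs : List A) i → removeAt xs i ≡ deleteAt xs (toℕ i)
    removeAt≡deleteAt (x ∷ xs) fzero    = refl
    removeAt≡deleteAt (x ∷ xs) (fsuc i) = cong (x ∷_) (removeAt≡deleteAt xs i)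

    nth-deleteAt-< : ∀ (xs : List A) i p → p < i → nth (deleteAt xs i) p ≡ nth xs p
    nth-deleteAt-< []       i       p       lt       = refl
    nth-deleteAt-< (x ∷ xs) (suc i) zero    lt       = refl
    nth-deleteAt-< (x ∷ xs) (suc i) (suc p) (s≤s lt) = nth-deleteAt-< xs i p lt

    nth-deleteAt-≥ : ∀ (xs : List A) i p → i ≤ p → nth (deleteAt xs i) p ≡ nth xs (suc p)
    nth-deleteAt-≥ []       i       p       le       = refl
    nth-deleteAt-≥ (x ∷ xs) zero    p       le       = refl
    nth-deleteAt-≥ (x ∷ xs) (suc i) (suc p) (s≤s le) = nth-deleteAt-≥ xs i p le

    length-deleteAt : ∀ (xs : List A) i → i < length xs → suc (length (deleteAt xs i)) ≡ length xs
    length-deleteAt (x ∷ xs) zero    lt       = refl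
    length-deleteAt (x ∷ xs) (suc i) (s≤s lt) = cong suc (length-deleteAt xs i lt)

    nth-applyUpTo : ∀ (f : ℕ → A) m p → p < m → nth (applyUpTo f m) p ≡ just (f p)
    nth-applyUpTo f (suc m) zero    lt       = refl
    nth-applyUpTo f (suc m) (suc p) (s≤s lt) = nth-applyUpTo (f ∘ suc) m p lt

    nth-applyUpTo-≥ : ∀ (f : ℕ → A) m p → m ≤ p → nth (applyUpTo f m) p ≡ nothing
    nth-applyUpTo-≥ f zero    p       le       = refl
    nth-applyUpTo-≥ f (suc m) (suc p) (s≤s le) = nth-applyUpTo-≥ (f ∘ suc) m p le

    applyUpTo-cong : ∀ (f g : ℕ → A) m → (∀ p → p < m → f p ≡ g p) → applyUpTo f m ≡ applyUpTo g m
    applyUpTo-cong f g zero    h = refl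
    applyUpTo-cong f g (suc m) h =
      cong₂ _∷_ (h 0 (s≤s z≤n)) (applyUpTo-cong (f ∘ suc) (g ∘ suc) m (λ p lt → h (suc p) (s≤s lt)))

    nth-++ˡ : ∀ (u w : List A) p → p < length u → nth (u ++ w) p ≡ nth u p
    nth-++ˡ (x ∷ u) w zero    lt       = refl
    nth-++ˡ (x ∷ u) w (suc p) (s≤s lt) = nth-++ˡ u w p lt

    nth-++ʳ : ∀ (u w : List A) p → nth (u ++ w) (length u + p) ≡ nth w p
    nth-++ʳ []      w p = refl
    nth-++ʳ (x ∷ u) w p = nth-++ʳ u w p

    split-at : ∀ (xs : List A) p → suc (suc p) ≤ length xs →
               Σ (List A) λ u → Σ A λ a → Σ A λ b → Σ (List A) λ v → xs ≡ u ++ a ∷ b ∷ v × length u ≡ p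
    split-at (x ∷ y ∷ xs) zero    le       = [] , x , y , xs , refl , refl
    split-at (x ∷ xs)     (suc p) (s≤s le) with split-at xs p le
    ... | u , a , b , v , refl , refl = x ∷ u , a , b , v , refl , refl

    nth-infix-first : ∀ u a b (v : List A) → nth (u ++ a ∷ b ∷ v) (length u) ≡ just a
    nth-infix-first u a b v =
      subst (λ t → nth (u ++ a ∷ b ∷ v) t ≡ just a) (NP.+-identityʳ (length u)) (nth-++ʳ u (a ∷ b ∷ v) 0)

    nth-infix-second : ∀ u a b (v : List A) → nth (u ++ a ∷ b ∷ v) (suc (length u)) ≡ just b
    nth-infix-second u a b v =
      subst (λ t → nth (u ++ a ∷ b ∷ v) t ≡ just b) (NP.+-comm (length u) 1) (nth-++ʳ u (a ∷ b ∷ v) 1)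

    nth-infix-after : ∀ u a b (v : List A) q → nth (u ++ a ∷ b ∷ v) (suc (suc (length u + q))) ≡ nth v q
    nth-infix-after u a b v q =
      subst (λ t → nth (u ++ a ∷ b ∷ v) t ≡ nth v q)
            (trans (NP.+-suc (length u) (suc q)) (cong suc (NP.+-suc (length u) q)))
            (nth-++ʳ u (a ∷ b ∷ v) (suc (suc q)))

    nth-infix-outside : ∀ (u v : List A) a b a′ b′ j → j ≢ length u → j ≢ suc (length u) →
                        nth (u ++ a ∷ b ∷ v) j ≡ nth (u ++ a′ ∷ b′ ∷ v) j
    nth-infix-outside u v a b a′ b′ j j≢t j≢t+1 with position (length u) j
    ... | before lt = trans (nth-++ˡ u _ j lt) (sym (nth-++ˡ u _ j lt))
    ... | first     = contradiction₀ (j≢t refl)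
    ... | second    = contradiction₀ (j≢t+1 refl)
    ... | after q   = trans (nth-infix-after u a b v q) (sym (nth-infix-after u a′ b′ v q))

    deleteAt-applyUpTo-cong : ∀ (f g : ℕ → A) m t → (∀ q → q ≢ t → f q ≡ g q) →
                              deleteAt (applyUpTo f m) t ≡ deleteAt (applyUpTo g m) t
    deleteAt-applyUpTo-cong f g m t h = nth-ext nth≡
      where
      nth-applyUpTo≡ : ∀ q → q ≢ t → nth (applyUpTo f m) q ≡ nth (applyUpTo g m) q
      nth-applyUpTo≡ q q≢t with q ℕ.<? m
      ... | yes q<m = trans (nth-applyUpTo f m q q<m) (trans (cong just (h q q≢t)) (sym (nth-applyUpTo g m q q<m)))
      ... | no  q≮m = trans (nth-applyUpTo-≥ f m q (NP.≮⇒≥ q≮m)) (sym (nth-applyUpTo-≥ g m q (NP.≮⇒≥ q≮m)))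
      nth≡ : ∀ p → nth (deleteAt (applyUpTo f m) t) p ≡ nth (deleteAt (applyUpTo g m) t) p
      nth≡ p with p ℕ.<? t
      ... | yes p<t = trans (nth-deleteAt-< (applyUpTo f m) t p p<t)
                        (trans (nth-applyUpTo≡ p (NP.<⇒≢ p<t)) (sym (nth-deleteAt-< (applyUpTo g m) t p p<t)))
      ... | no  p≮t = trans (nth-deleteAt-≥ (applyUpTo f m) t p (NP.≮⇒≥ p≮t))
                        (trans (nth-applyUpTo≡ (suc p) (NP.<⇒≢ (s≤s (NP.≮⇒≥ p≮t)) ∘ sym))
                               (sym (nth-deleteAt-≥ (applyUpTo g m) t p (NP.≮⇒≥ p≮t))))

    deleteAt-≡⇒nth-≡ : ∀ (xs ys : List A) t q → deleteAt xs t ≡ deleteAt ys t → q ≢ t → nth xs q ≡ nth ys q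
    deleteAt-≡⇒nth-≡ xs ys t q e q≢t with q ℕ.<? t
    ... | yes q<t = trans (sym (nth-deleteAt-< xs t q q<t)) (trans (cong (λ l → nth l q) e) (nth-deleteAt-< ys t q q<t))
    deleteAt-≡⇒nth-≡ xs ys t zero    e q≢t | no q≮t = contradiction₀ (q≢t (sym (NP.n≤0⇒n≡0 (NP.≮⇒≥ q≮t))))
    deleteAt-≡⇒nth-≡ xs ys t (suc p) e q≢t | no q≮t =
      trans (sym (nth-deleteAt-≥ xs t p t≤p)) (trans (cong (λ l → nth l p) e) (nth-deleteAt-≥ ys t p t≤p))
      where
      t≤p : t ≤ p
      t≤p = NP.≤-pred (NP.≤∧≢⇒< (NP.≮⇒≥ q≮t) (q≢t ∘ sym))

    All-deleteAt : ∀ {p} {P : A → Set p} (xs : List A) i → All P xs → All P (deleteAt xs i)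
    All-deleteAt []       i       ps       = ps
    All-deleteAt (x ∷ xs) zero    (_ ∷ ps) = ps
    All-deleteAt (x ∷ xs) (suc i) (p ∷ ps) = p ∷ All-deleteAt xs i ps

    Linked-deleteAt : ∀ {r} {R : A → A → Set r} → (∀ {x y z} → R x y → R y z → R x z) →
                      ∀ (xs : List A) i → Linked R xs → Linked R (deleteAt xs i)
    Linked-deleteAt trans-R []               i             l              = l
    Linked-deleteAt trans-R (x ∷ [])         zero          l              = []
    Linked-deleteAt trans-R (x ∷ [])         (suc i)       l              = [-]
    Linked-deleteAt trans-R (x ∷ y ∷ xs)     zero          (_ ∷ l)        = l
    Linked-deleteAt trans-R (x ∷ y ∷ [])     (suc zero)    _              = [-]
    Linked-deleteAt trans-R (x ∷ y ∷ z ∷ xs) (suc zero)    (r ∷ r′ ∷ l)   = trans-R r r′ ∷ l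
    Linked-deleteAt trans-R (x ∷ y ∷ xs)     (suc (suc i)) (r ∷ l)        = r ∷ Linked-deleteAt trans-R (y ∷ xs) (suc i) l

  -- Words as walks in the weighted boolean algebra

  module Walks (n k : ℕ) where
    open Vertices n k public

    walk : V → Word n → ℕ → V
    walk v w       zero    = v
    walk v []      (suc j) = v
    walk v (l ∷ w) (suc j) = walk (extend l v) w j

    walk-extend : ∀ l v w j → walk (extend l v) w j ≡ extend l (walk v w j)
    walk-extend l v w       zero    = refl
    walk-extend l v []      (suc j) = refl
    walk-extend l v (m ∷ w) (suc j) =
      trans (cong (λ u → walk u w j) (extend-comm m l v)) (walk-extend l (extend m v) w j)

    foldr-extend≡walk : ∀ v (σ : Word n) j → foldr extend v (take j σ) ≡ walk v σ j
    foldr-extend≡walk v σ       zero    = refl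
    foldr-extend≡walk v []      (suc j) = refl
    foldr-extend≡walk v (l ∷ σ) (suc j) = trans (cong (extend l) (foldr-extend≡walk v σ j)) (sym (walk-extend l v σ j))

    walk-suc : ∀ v (ω : Word n) j l → nth ω j ≡ just l → walk v ω (suc j) ≡ extend l (walk v ω j)
    walk-suc v (m ∷ ω) zero    l refl = refl
    walk-suc v (m ∷ ω) (suc j) l e    = walk-suc (extend m v) ω j l e

    walk-++ʳ : ∀ v (u w : Word n) j → walk v (u ++ w) (length u + j) ≡ walk (walk v u (length u)) w j
    walk-++ʳ v []      w j = refl
    walk-++ʳ v (l ∷ u) w j = walk-++ʳ (extend l v) u w j

    walk-++ˡ : ∀ v (u w : Word n) j → j ≤ length u → walk v (u ++ w) j ≡ walk v u j
    walk-++ˡ v u       w zero    le       = refl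
    walk-++ˡ v (l ∷ u) w (suc j) (s≤s le) = walk-++ˡ (extend l v) u w j le

    data FreshWord : V → Word n → Set where
      []  : ∀ {v} → FreshWord v []
      _∷_ : ∀ {v l w} → Fresh l v → FreshWord (extend l v) w → FreshWord v (l ∷ w)

    FreshWord-nth : ∀ {v ω} → FreshWord v ω → ∀ j l → nth ω j ≡ just l → Fresh l (walk v ω j)
    FreshWord-nth (fresh ∷ _) zero    l refl = fresh
    FreshWord-nth (_ ∷ f)     (suc j) l e    = FreshWord-nth f j l e

    rank-walk : ∀ {v ω} → FreshWord v ω → ∀ j → j ≤ length ω → rank (walk v ω j) ≡ j + rank v
    rank-walk         f             zero    _        = refl
    rank-walk {v} {l ∷ ω} (fresh ∷ f) (suc j) (s≤s le) =
      trans (rank-walk f j le) (trans (cong (j +_) (rank-extend l v fresh)) (NP.+-suc j (rank v)))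

    data Between : V → List V → V → Set where
      end  : ∀ {lo hi} → lo <ᵥ hi → Between lo [] hi
      cons : ∀ {lo v vs hi} → lo <ᵥ v → IsWeighted v → Between v vs hi → Between lo (v ∷ vs) hi

    Between⇒<ᵥ : ∀ {lo vs hi} → Between lo vs hi → lo <ᵥ hi
    Between⇒<ᵥ (end lt)      = lt
    Between⇒<ᵥ (cons lt _ b) = <ᵥ-trans lt (Between⇒<ᵥ b)

    Between-rank : ∀ {lo vs hi} → Between lo vs hi → IsWeighted lo → IsWeighted hi → suc (length vs + rank lo) ≤ rank hi
    Between-rank (end lt) wl wh = rank-strict lt wl wh
    Between-rank {lo} (cons {vs = vs} lt w b) wl wh = NP.≤-trans
      (s≤s (NP.≤-trans (NP.≤-reflexive (sym (NP.+-suc (length vs) (rank lo)))) (NP.+-monoʳ-≤ (length vs) (rank-strict lt wl w))))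
      (Between-rank b w wh)

    FreshWord⇒Between : ∀ {v ω} m → FreshWord v ω → IsWeighted v → length ω ≡ suc m →
                        Between v (applyUpTo (walk v ω ∘ suc) m) (walk v ω (suc m))
    FreshWord⇒Between {v} {l ∷ []}    zero    (fresh ∷ f) w _ = end (<ᵥ-extend l v fresh)
    FreshWord⇒Between {v} {l ∷ ω}     (suc m) (fresh ∷ f) w e =
      cons (<ᵥ-extend l v fresh) w′ (FreshWord⇒Between m f w′ (NP.suc-injective e))
      where
      w′ : IsWeighted (extend l v)
      w′ = IsWeighted-extend l v fresh w

    Between⇒FreshWord : ∀ {lo vs hi} → Between lo vs hi → IsWeighted lo → IsWeighted hi →
      rank hi ≡ suc (length vs + rank lo) →
      Σ (Word n) λ ω → FreshWord lo ω × length ω ≡ suc (length vs) ×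
                       vs ≡ applyUpTo (walk lo ω ∘ suc) (length vs) × hi ≡ walk lo ω (suc (length vs))
    Between⇒FreshWord {lo} {[]} {hi} (end lt) wl wh r with cover⇒extend lo hi (proj₁ lt) wl wh r
    ... | l , fresh , e = l ∷ [] , fresh ∷ [] , refl , refl , e
    Between⇒FreshWord {lo} {v ∷ vs} {hi} (cons lt wv b) wl wh r with cover⇒extend lo v (proj₁ lt) wl wv rank-v
      where
      rank-v : rank v ≡ suc (rank lo)
      rank-v = NP.≤-antisym
        (NP.+-cancelˡ-≤ (length vs) _ _ (subst (length vs + rank v ≤_) (sym (NP.+-suc (length vs) (rank lo)))
          (NP.≤-pred (subst (suc (length vs + rank v) ≤_) r (Between-rank b wv wh)))))
        (rank-strict lt wl wv)
    ... | l , fresh , refl with Between⇒FreshWord b wv wh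
          (trans r (cong suc (trans (sym (NP.+-suc (length vs) (rank lo))) (cong (length vs +_) (sym (rank-extend l lo fresh))))))
    ...   | ω , f , len , e₁ , e₂ = l ∷ ω , fresh ∷ f , cong suc len , cong (extend l lo ∷_) e₁ , e₂

    insert-missing-vertex : ∀ {lo vs hi} → Between lo vs hi → IsWeighted lo → IsWeighted hi →
      rank hi ≡ suc (suc (length vs + rank lo)) →
      Σ (List V) λ vs′ → Σ ℕ λ p → Between lo vs′ hi × vs ≡ deleteAt vs′ p × p ≤ length vs × length vs′ ≡ suc (length vs)
    insert-missing-vertex {lo} {[]} {hi} (end lt) wl wh r with interpolate lo hi (proj₁ lt) wl wh r
    ... | m , lo<m , m<hi , wm = m ∷ [] , 0 , cons lo<m wm (end m<hi) , refl , z≤n , refl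
    insert-missing-vertex {lo} {v ∷ vs} {hi} (cons lt wv b) wl wh r with NP.m≤n⇒m<n∨m≡n (rank-strict lt wl wv)
    ... | inj₂ e with insert-missing-vertex b wv wh
          (trans r (cong (suc ∘ suc) (trans (sym (NP.+-suc (length vs) (rank lo))) (cong (length vs +_) e))))
    ...   | vs′ , p , b′ , e′ , le , len = v ∷ vs′ , suc p , cons lt wv b′ , cong (v ∷_) e′ , s≤s le , cong suc len
    insert-missing-vertex {lo} {v ∷ vs} {hi} (cons lt wv b) wl wh r | inj₁ gt with interpolate lo v (proj₁ lt) wl wv rank-v
      where
      rank-v : rank v ≡ suc (suc (rank lo))
      rank-v = NP.≤-antisym
        (NP.+-cancelˡ-≤ (length vs) _ _
          (subst (length vs + rank v ≤_) (trans (cong suc (sym (NP.+-suc (length vs) (rank lo)))) (sym (NP.+-suc (length vs) (suc (rank lo)))))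
            (NP.≤-pred (subst (suc (length vs + rank v) ≤_) r (Between-rank b wv wh)))))
        gt
    ... | m , lo<m , m<v , wm = m ∷ v ∷ vs , 0 , cons lo<m wm (cons m<v wv b) , refl , z≤n , refl

    InInterval : V → V → V → Set
    InInterval lo hi x = IsWeighted x × lo <ᵥ x × x <ᵥ hi

    Between⇒chain : ∀ {lo vs hi} → Between lo vs hi → All (InInterval lo hi) vs × Linked _<ᵥ_ vs
    Between⇒chain (end lt) = [] , []
    Between⇒chain (cons lt w b) with Between⇒chain b
    ... | inside , linked =
      (w , lt , Between⇒<ᵥ b) ∷ All.map (λ { (w′ , l′ , h′) → w′ , <ᵥ-trans lt l′ , h′ }) inside , linked-cons b linked
      where
      linked-cons : ∀ {v vs hi} → Between v vs hi → Linked _<ᵥ_ vs → Linked _<ᵥ_ (v ∷ vs)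
      linked-cons (end _)        _ = [-]
      linked-cons (cons lt _ _) l = lt ∷ l

    chain⇒Between : ∀ {lo hi} (vs : List V) → lo <ᵥ hi → All (InInterval lo hi) vs → Linked _<ᵥ_ vs → Between lo vs hi
    chain⇒Between []       lo<hi _                 _      = end lo<hi
    chain⇒Between {lo} {hi} (v ∷ vs) _ ((w , l , u) ∷ inside) linked = cons l w (from v vs u inside linked)
      where
      from : ∀ v vs → v <ᵥ hi → All (InInterval lo hi) vs → Linked _<ᵥ_ (v ∷ vs) → Between v vs hi
      from v []        u _                   _            = end u
      from v (v′ ∷ vs) u ((w′ , _ , u′) ∷ a) (r ∷ linked) = cons r w′ (from v′ vs u′ a linked)

  -- Coloured permutations

  letters : ∀ {n} → Word n → List (Fin n)
  letters = map proj₁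

  count : ∀ {n} → ℕ → Word n → ℕ
  count j σ = length (filter (λ l → proj₂ l ℕ.≟ j) σ)

  count-∷-≡ : ∀ {n} j (l : CLetter n) σ → proj₂ l ≡ j → count j (l ∷ σ) ≡ suc (count j σ)
  count-∷-≡ j l σ e = cong length (ListP.filter-accept (λ l → proj₂ l ℕ.≟ j) e)

  count-∷-≢ : ∀ {n} j (l : CLetter n) σ → proj₂ l ≢ j → count j (l ∷ σ) ≡ count j σ
  count-∷-≢ j l σ e = cong length (ListP.filter-reject (λ l → proj₂ l ℕ.≟ j) e)

  count-≥ : ∀ {n} k j (σ : Word n) → All (λ l → proj₂ l < k) σ → k ≤ j → count j σ ≡ 0
  count-≥ k j []            _          _    = refl
  count-≥ k j ((x , c) ∷ σ) (c<k ∷ cs) k≤j with c ℕ.≟ j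
  ... | yes refl = contradiction₀ (NP.<-irrefl refl (NP.<-≤-trans c<k k≤j))
  ... | no c≢j   = trans (count-∷-≢ j (x , c) σ c≢j) (count-≥ k j σ cs k≤j)

  ∈⇒count≥1 : ∀ {n} (l : CLetter n) (σ : Word n) → l ∈ σ → 1 ≤ count (proj₂ l) σ
  ∈⇒count≥1 l (m ∷ σ) (here refl) = subst (1 ≤_) (sym (count-∷-≡ (proj₂ l) l σ refl)) (s≤s z≤n)
  ∈⇒count≥1 l (m ∷ σ) (there i) with proj₂ m ℕ.≟ proj₂ l
  ... | yes e  = subst (1 ≤_) (sym (count-∷-≡ (proj₂ l) m σ e)) (NP.≤-trans (∈⇒count≥1 l σ i) (NP.n≤1+n _))
  ... | no  ne = subst (1 ≤_) (sym (count-∷-≢ (proj₂ l) m σ ne)) (∈⇒count≥1 l σ i)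

  count-∷ : ∀ {n} j (l : CLetter n) σ → count j (l ∷ σ) ≡ (if ⌊ proj₂ l ℕ.≟ j ⌋ then 1 else 0) + count j σ
  count-∷ j l σ with proj₂ l ℕ.≟ j
  ... | yes e  = count-∷-≡ j l σ e
  ... | no  ne = count-∷-≢ j l σ ne

  count-++ : ∀ {n} j (u w : Word n) → count j (u ++ w) ≡ count j u + count j w
  count-++ j u w = trans (cong length (ListP.filter-++ (λ l → proj₂ l ℕ.≟ j) u w)) (ListP.length-++ (filter _ u))

  count-swap : ∀ {n} j (l₁ l₂ : CLetter n) σ → count j (l₁ ∷ l₂ ∷ σ) ≡ count j (l₂ ∷ l₁ ∷ σ)
  count-swap j l₁ l₂ σ = begin
    count j (l₁ ∷ l₂ ∷ σ)           ≡⟨ count-∷ j l₁ _ ⟩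
    ι l₁ + count j (l₂ ∷ σ)         ≡⟨ cong (ι l₁ +_) (count-∷ j l₂ σ) ⟩
    ι l₁ + (ι l₂ + count j σ)       ≡⟨ left-comm NP.+-assoc NP.+-comm (ι l₁) (ι l₂) _ ⟩
    ι l₂ + (ι l₁ + count j σ)       ≡⟨ cong (ι l₂ +_) (count-∷ j l₁ σ) ⟨
    ι l₂ + count j (l₁ ∷ σ)         ≡⟨ count-∷ j l₂ _ ⟨
    count j (l₂ ∷ l₁ ∷ σ)           ∎
    where
    open ≡-Reasoning
    ι : CLetter _ → ℕ
    ι l = if ⌊ proj₂ l ℕ.≟ j ⌋ then 1 else 0

  count-colours : ∀ {n} j (σ ρ : Word n) → map proj₂ σ ≡ map proj₂ ρ → count j σ ≡ count j ρ
  count-colours j []      []      _ = refl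
  count-colours j (l ∷ σ) (m ∷ ρ) e with ListP.∷-injective e
  ... | refl , e′ = trans (count-∷ j l σ) (trans (cong (_ +_) (count-colours j σ ρ e′)) (sym (count-∷ j m ρ)))

  IsColPerm-infix : ∀ {n μ} (u w w′ v : Word n) → letters w ↭ letters w′ → (∀ j → count j w ≡ count j w′) →
                    IsColPerm n μ (u ++ w ++ v) → IsColPerm n μ (u ++ w′ ++ v)
  IsColPerm-infix u w w′ v w↭w′ count≡ (p , count≡at) =
    ↭-trans (↭-sym letters↭) p , λ j → trans (sym (counts j)) (count≡at j)
    where
    letters↭ : letters (u ++ w ++ v) ↭ letters (u ++ w′ ++ v)
    letters↭ = subst₂ _↭_ (sym (trans (ListP.map-++ proj₁ u _) (cong (letters u ++_) (ListP.map-++ proj₁ w v))))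
                          (sym (trans (ListP.map-++ proj₁ u _) (cong (letters u ++_) (ListP.map-++ proj₁ w′ v))))
                          (↭P.++⁺ˡ (letters u) (↭P.++⁺ʳ (letters v) w↭w′))
    counts : ∀ j → count j (u ++ w ++ v) ≡ count j (u ++ w′ ++ v)
    counts j = begin
      count j (u ++ w ++ v)                    ≡⟨ count-++ j u _ ⟩
      count j u + count j (w ++ v)             ≡⟨ cong (count j u +_) (count-++ j w v) ⟩
      count j u + (count j w + count j v)      ≡⟨ cong (λ c → count j u + (c + count j v)) (count≡ j) ⟩
      count j u + (count j w′ + count j v)     ≡⟨ cong (count j u +_) (count-++ j w′ v) ⟨
      count j u + count j (w′ ++ v)            ≡⟨ count-++ j u _ ⟨
      count j (u ++ w′ ++ v)                   ∎
      where open ≡-Reasoning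

  Reordering-letters : ∀ {n} {x y : Fin n} {a b l₁ l₂} → Reordering x y a b l₁ l₂ →
                       letters (l₁ ∷ l₂ ∷ []) ↭ letters ((x , a) ∷ (y , b) ∷ [])
  Reordering-letters ⟨xa,yb⟩ = ↭-refl
  Reordering-letters ⟨ya,xb⟩ = swap _ _ ↭-refl
  Reordering-letters ⟨yb,xa⟩ = swap _ _ ↭-refl
  Reordering-letters ⟨xb,ya⟩ = ↭-refl

  Reordering-count : ∀ {n} {x y : Fin n} {a b l₁ l₂} → Reordering x y a b l₁ l₂ →
                     ∀ j → count j (l₁ ∷ l₂ ∷ []) ≡ count j ((x , a) ∷ (y , b) ∷ [])
  Reordering-count                         ⟨xa,yb⟩ j = refl
  Reordering-count {x = x} {y} {a} {b}     ⟨ya,xb⟩ j = count-colours j ((y , a) ∷ (x , b) ∷ []) ((x , a) ∷ (y , b) ∷ []) refl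
  Reordering-count {x = x} {y} {a} {b}     ⟨yb,xa⟩ j = count-swap j (y , b) (x , a) []
  Reordering-count {x = x} {y} {a} {b}     ⟨xb,ya⟩ j =
    trans (count-swap j (x , b) (y , a) []) (count-colours j ((y , a) ∷ (x , b) ∷ []) ((x , a) ∷ (y , b) ∷ []) refl)

  Unique∧complete⇒↭allFin : ∀ {n} (xs : List (Fin n)) → Unique xs → (∀ x → x ∈ xs) → xs ↭ allFin n
  Unique∧complete⇒↭allFin {n} xs u complete =
    ∼bag⇒↭ (unique∧set⇒bag u (UniqueP.allFin⁺ n) (λ {x} → mk⇔ (λ _ → ∈P.∈-allFin x) (λ _ → complete x)))

  ↭allFin⇒Unique : ∀ {n} (xs : List (Fin n)) → xs ↭ allFin n → Unique xs
  ↭allFin⇒Unique {n} xs p = ↭ₛP.Unique-resp-↭ (≡.setoid (Fin n)) (↭⇒↭ₛ (↭-sym p)) (UniqueP.allFin⁺ n)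

  at≡lookup-fromList : ∀ (μ : List ℕ) (c : Fin (length μ)) → at μ (toℕ c) ≡ lookup (Vec.fromList μ) c
  at≡lookup-fromList (m ∷ μ) fzero    = refl
  at≡lookup-fromList (m ∷ μ) (fsuc c) = at≡lookup-fromList μ c

  at-≥length : ∀ (μ : List ℕ) j → length μ ≤ j → at μ j ≡ 0
  at-≥length []      j       _        = refl
  at-≥length (m ∷ μ) (suc j) (s≤s le) = at-≥length μ j le

  at-sum≡0 : ∀ (μ : List ℕ) j → sum μ ≡ 0 → at μ j ≡ 0
  at-sum≡0 []           j       _ = refl
  at-sum≡0 (zero ∷ μ) zero    _ = refl
  at-sum≡0 (zero ∷ μ) (suc j) e = at-sum≡0 μ j e

  sum-fromList : ∀ (μ : List ℕ) → Vec.sum (Vec.fromList μ) ≡ sum μ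
  sum-fromList []      = refl
  sum-fromList (m ∷ μ) = cong (m +_) (sum-fromList μ)

  zero⊎suc : ∀ n → n ≡ 0 ⊎ Σ ℕ λ m → n ≡ suc m
  zero⊎suc zero    = inj₁ refl
  zero⊎suc (suc m) = inj₂ (m , refl)

  <∸1 : ∀ {q m} → suc q ≤ m → suc q ≢ m → q < m ∸ 1
  <∸1 (s≤s q≤m) q+1≢m = NP.≤∧≢⇒< q≤m (q+1≢m ∘ cong suc)

  module Colourings (n : ℕ) (μ : List ℕ) where
    k : ℕ
    k = length μ
    open Walks n k public

    ⊥ᵥ ⊤ᵥ : V
    ⊥ᵥ = bot n k
    ⊤ᵥ = top n μ

    IsWeighted-⊥ᵥ : IsWeighted ⊥ᵥ
    IsWeighted-⊥ᵥ = trans (SubP.∣⊥∣≡0 n) (sym (sum-replicate-0 k))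

    vertexOf : Word n → ℕ → V
    vertexOf σ = walk ⊥ᵥ σ

    prefixVertex≡vertexOf : ∀ σ i → prefixVertex μ σ i ≡ vertexOf σ i
    prefixVertex≡vertexOf σ i = trans (foldr-pair (take i σ)) (foldr-extend≡walk ⊥ᵥ σ i)
      where
      foldr-pair : ∀ (xs : Word n) →
        (foldr (λ l B → ⁅ proj₁ l ⁆ ∪ B) Sub.⊥ xs , foldr (λ l ν → zipWith _+_ (unitVec k (proj₂ l)) ν) (replicate k 0) xs)
        ≡ foldr extend ⊥ᵥ xs
      foldr-pair []      = refl
      foldr-pair (l ∷ xs) = cong (extend l) (foldr-pair xs)

    cbar≡vertexOf : ∀ σ → cbar μ σ ≡ applyUpTo (vertexOf σ ∘ suc) (n ∸ 1)
    cbar≡vertexOf σ = trans (ListP.map-applyUpTo suc (prefixVertex μ σ) (n ∸ 1))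
                            (applyUpTo-cong _ _ _ (λ p _ → prefixVertex≡vertexOf σ (suc p)))

    walk-set-mono : ∀ v (σ : Word n) j x → lookup (proj₁ v) x ≡ true → lookup (proj₁ (walk v σ j)) x ≡ true
    walk-set-mono v σ       zero    x e = e
    walk-set-mono v []      (suc j) x e = e
    walk-set-mono v (l ∷ σ) (suc j) x e =
      walk-set-mono (extend l v) σ j x (lookup-p⇒lookup-⁅x⁆∪p (proj₁ l) (proj₁ v) x e)

    walk-set-letters : ∀ v (σ : Word n) x → x ∈ letters σ → lookup (proj₁ (walk v σ (length σ))) x ≡ true
    walk-set-letters v (l ∷ σ) x (here refl) = walk-set-mono (extend l v) σ (length σ) x (lookup-⁅x⁆∪p-self x (proj₁ v))
    walk-set-letters v (l ∷ σ) x (there i)   = walk-set-letters (extend l v) σ x i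

    walk-set⁻ : ∀ v (σ : Word n) j x → lookup (proj₁ (walk v σ j)) x ≡ true → lookup (proj₁ v) x ≡ true ⊎ x ∈ letters σ
    walk-set⁻ v σ       zero    x e = inj₁ e
    walk-set⁻ v []      (suc j) x e = inj₁ e
    walk-set⁻ v (l ∷ σ) (suc j) x e with walk-set⁻ (extend l v) σ j x e
    ... | inj₂ i  = inj₂ (there i)
    ... | inj₁ e′ with lookup-⁅x⁆∪p⁻ (proj₁ l) (proj₁ v) x e′
    ...   | inj₁ refl = inj₂ (here refl)
    ...   | inj₂ x∈v  = inj₁ x∈v

    walk-weight : ∀ v (σ : Word n) (c : Fin k) →
                  lookup (proj₂ (walk v σ (length σ))) c ≡ lookup (proj₂ v) c + count (toℕ c) σ
    walk-weight v []      c = sym (NP.+-identityʳ _)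
    walk-weight v (l ∷ σ) c =
      trans (walk-weight (extend l v) σ c)
            (trans (cong (_+ count (toℕ c) σ) (lookup-zipWith-+ (unitVec k (proj₂ l)) (proj₂ v) c)) (step (proj₂ l)))
      where
      vc : ℕ
      vc = lookup (proj₂ v) c
      step : ∀ d → lookup (unitVec k d) c + vc + count (toℕ c) σ ≡ vc + count (toℕ c) ((proj₁ l , d) ∷ σ)
      step d with d ℕ.≟ toℕ c
      ... | yes refl rewrite lookup-unitVec-self k c | count-∷-≡ (toℕ c) (proj₁ l , toℕ c) σ refl =
            trans (cong (_+ count (toℕ c) σ) (NP.+-comm 1 vc)) (NP.+-assoc vc 1 _)
      ... | no d≢c rewrite lookup-unitVec-other k d c (d≢c ∘ sym) | count-∷-≢ (toℕ c) (proj₁ l , d) σ d≢c = refl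

    Outside : V → Word n → Set
    Outside v σ = All (λ x → lookup (proj₁ v) x ≡ false) (letters σ)

    FreshWord⇒distinct : ∀ {v σ} → FreshWord v σ → Unique (letters σ) × Outside v σ × All (λ l → proj₂ l < k) σ
    FreshWord⇒distinct [] = [] , [] , []
    FreshWord⇒distinct {v} {l ∷ σ} ((x∉v , c<k) ∷ f) with FreshWord⇒distinct f
    ... | u , outside , cs = All.map (≢-l _) outside ∷ u , x∉v ∷ All.map (outside-v _) outside , c<k ∷ cs
      where
      in-extend : ∀ y → lookup (proj₁ (extend l v)) y ≡ false → lookup ⁅ proj₁ l ⁆ y ∨ lookup (proj₁ v) y ≡ false
      in-extend y e = trans (sym (lookup-∪ ⁅ proj₁ l ⁆ (proj₁ v) y)) e
      ≢-l : ∀ y → lookup (proj₁ (extend l v)) y ≡ false → proj₁ l ≢ y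
      ≢-l y e refl with trans (sym (lookup-⁅x⁆∪p-self y (proj₁ v))) e
      ... | ()
      outside-v : ∀ y → lookup (proj₁ (extend l v)) y ≡ false → lookup (proj₁ v) y ≡ false
      outside-v y e with lookup ⁅ proj₁ l ⁆ y | in-extend y e
      ... | false | e′ = e′

    distinct⇒FreshWord : ∀ v (σ : Word n) → Unique (letters σ) → Outside v σ → All (λ l → proj₂ l < k) σ → FreshWord v σ
    distinct⇒FreshWord v []      _          _              _          = []
    distinct⇒FreshWord v (l ∷ σ) (l∉σ ∷ u) (x∉v ∷ outside) (c<k ∷ cs) =
      (x∉v , c<k) ∷ distinct⇒FreshWord (extend l v) σ u
        (All.zipWith (λ { (x≢y , y∉v) → lookup-⁅x⁆∪p-fresh (proj₁ l) (proj₁ v) _ x≢y y∉v }) (l∉σ , outside)) cs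

    ColPerm′ : Word n → Set
    ColPerm′ σ = Unique (letters σ) × (∀ x → x ∈ letters σ) × All (λ l → proj₂ l < k) σ
               × (∀ (c : Fin k) → count (toℕ c) σ ≡ lookup (Vec.fromList μ) c)

    ColPerm′⇒IsColPerm : ∀ σ → ColPerm′ σ → IsColPerm n μ σ
    ColPerm′⇒IsColPerm σ (u , complete , cs , cnt) = Unique∧complete⇒↭allFin (letters σ) u complete , count≡at
      where
      count≡at : ∀ j → count j σ ≡ at μ j
      count≡at j with j ℕ.<? k
      ... | yes j<k = begin
            count j σ                            ≡⟨ cong (λ t → count t σ) (sym (FinP.toℕ-fromℕ< j<k)) ⟩
            count (toℕ (fromℕ< j<k)) σ           ≡⟨ cnt (fromℕ< j<k) ⟩
            lookup (Vec.fromList μ) (fromℕ< j<k) ≡⟨ sym (at≡lookup-fromList μ (fromℕ< j<k)) ⟩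
            at μ (toℕ (fromℕ< j<k))              ≡⟨ cong (at μ) (FinP.toℕ-fromℕ< j<k) ⟩
            at μ j                               ∎
        where open ≡-Reasoning
      ... | no j≮k = trans (count-≥ k j σ cs (NP.≮⇒≥ j≮k)) (sym (at-≥length μ j (NP.≮⇒≥ j≮k)))

    IsColPerm⇒ColPerm′ : ∀ σ → IsColPerm n μ σ → ColPerm′ σ
    IsColPerm⇒ColPerm′ σ (p , count≡at) =
      ↭allFin⇒Unique _ p , (λ x → ↭P.∈-resp-↭ (↭-sym p) (∈P.∈-allFin x)) ,
      All.tabulate (λ {l} → colour<k l) , λ c → trans (count≡at (toℕ c)) (at≡lookup-fromList μ c)
      where
      colour<k : ∀ l → l ∈ σ → proj₂ l < k
      colour<k l i with proj₂ l ℕ.<? k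
      ... | yes lt = lt
      ... | no nl  = contradiction₀ (NP.<-irrefl refl
            (NP.≤-trans (∈⇒count≥1 l σ i) (NP.≤-reflexive (trans (count≡at (proj₂ l)) (at-≥length μ _ (NP.≮⇒≥ nl))))))

    IsColPerm⇒FreshWord : ∀ σ → IsColPerm n μ σ → FreshWord ⊥ᵥ σ × length σ ≡ n × vertexOf σ n ≡ ⊤ᵥ
    IsColPerm⇒FreshWord σ cp@(p , _) with IsColPerm⇒ColPerm′ σ cp
    ... | u , complete , cs , cnt =
      distinct⇒FreshWord ⊥ᵥ σ u (All.tabulate (λ {x} _ → lookup-⊥ x)) cs , len ,
      trans (cong (vertexOf σ) (sym len)) (cong₂ _,_ (lookup-ext set≡) (lookup-ext weight≡))
      where
      len : length σ ≡ n
      len = trans (sym (ListP.length-map proj₁ σ)) (trans (↭P.↭-length p) (ListP.length-tabulate id))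
      set≡ : ∀ x → lookup (proj₁ (vertexOf σ (length σ))) x ≡ lookup (proj₁ ⊤ᵥ) x
      set≡ x = trans (walk-set-letters ⊥ᵥ σ x (complete x)) (sym (lookup-⊤ x))
      weight≡ : ∀ c → lookup (proj₂ (vertexOf σ (length σ))) c ≡ lookup (proj₂ ⊤ᵥ) c
      weight≡ c = trans (walk-weight ⊥ᵥ σ c) (trans (cong (_+ count (toℕ c) σ) (VecP.lookup-replicate c 0)) (cnt c))

    FreshWord⇒IsColPerm : ∀ σ → FreshWord ⊥ᵥ σ → vertexOf σ (length σ) ≡ ⊤ᵥ → IsColPerm n μ σ
    FreshWord⇒IsColPerm σ f e with FreshWord⇒distinct f
    ... | u , _ , cs = ColPerm′⇒IsColPerm σ (u , complete , cs , cnt)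
      where
      complete : ∀ x → x ∈ letters σ
      complete x with walk-set⁻ ⊥ᵥ σ (length σ) x (trans (cong (λ t → lookup (proj₁ t) x) e) (lookup-⊤ x))
      ... | inj₂ i   = i
      ... | inj₁ x∈⊥ with trans (sym (lookup-⊥ x)) x∈⊥
      ...   | ()
      cnt : ∀ c → count (toℕ c) σ ≡ lookup (Vec.fromList μ) c
      cnt c = trans (sym (trans (walk-weight ⊥ᵥ σ c) (cong (_+ count (toℕ c) σ) (VecP.lookup-replicate c 0))))
                    (cong (λ t → lookup (proj₂ t) c) e)

    length-cbar : ∀ (σ : Word n) → length (cbar μ σ) ≡ n ∸ 1
    length-cbar σ = trans (ListP.length-map (prefixVertex μ σ) (applyUpTo suc (n ∸ 1))) (ListP.length-applyUpTo suc (n ∸ 1))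

    toℕ<n∸1 : ∀ (σ : Word n) (i : Fin (length (cbar μ σ))) → toℕ i < n ∸ 1
    toℕ<n∸1 σ i = subst (toℕ i <_) (length-cbar σ) (FinP.toℕ<n i)

    rank-⊤ᵥ : rank ⊤ᵥ ≡ n
    rank-⊤ᵥ = SubP.∣⊤∣≡n n

    rank-⊥ᵥ : rank ⊥ᵥ ≡ 0
    rank-⊥ᵥ = SubP.∣⊥∣≡0 n

    ⊥ᵥ<ᵥ⊤ᵥ : 1 ≤ n → ⊥ᵥ <ᵥ ⊤ᵥ
    ⊥ᵥ<ᵥ⊤ᵥ 1≤n =
      (SubP.⊆-max Sub.⊥ , ≤ʷ-tabulate (λ c → subst (_≤ lookup (Vec.fromList μ) c) (sym (VecP.lookup-replicate c 0)) z≤n)) ,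
      rank-≢⇒≢ (λ r → NP.<-irrefl (trans (sym rank-⊥ᵥ) (trans r rank-⊤ᵥ)) 1≤n)

    IsWeighted-⊤ᵥ : sum μ ≡ n → IsWeighted ⊤ᵥ
    IsWeighted-⊤ᵥ s = trans (SubP.∣⊤∣≡n n) (trans (sym s) (sym (sum-fromList μ)))

    IsColPerm⇒IsMaxChain : ∀ σ → IsColPerm n μ σ → IsMaxChainOI n μ (cbar μ σ)
    IsColPerm⇒IsMaxChain σ cp =
      subst (IsChainOI n μ) (sym (cbar≡vertexOf σ)) (vertices-chain (zero⊎suc n)) , length-cbar σ
      where
      vertices-chain : n ≡ 0 ⊎ Σ ℕ (λ m → n ≡ suc m) → IsChainOI n μ (applyUpTo (vertexOf σ ∘ suc) (n ∸ 1))
      vertices-chain (inj₁ refl)       = [] , []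
      vertices-chain (inj₂ (m , refl)) with IsColPerm⇒FreshWord σ cp
      ... | f , len , reaches-⊤ =
        Between⇒chain (subst (Between ⊥ᵥ _) reaches-⊤ (FreshWord⇒Between m f IsWeighted-⊥ᵥ len))

    module _ {σ : Word n} (cp : IsColPerm n μ σ) where

      length-colPerm : length σ ≡ n
      length-colPerm = proj₁ (proj₂ (IsColPerm⇒FreshWord σ cp))

      vertexOf-n : vertexOf σ n ≡ ⊤ᵥ
      vertexOf-n = proj₂ (proj₂ (IsColPerm⇒FreshWord σ cp))

      rank-vertexOf : ∀ j → j ≤ n → rank (vertexOf σ j) ≡ j
      rank-vertexOf j j≤n =
        trans (rank-walk (proj₁ (IsColPerm⇒FreshWord σ cp)) j (subst (j ≤_) (sym length-colPerm) j≤n))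
              (trans (cong (j +_) rank-⊥ᵥ) (NP.+-identityʳ j))

      Fresh-nth : ∀ j l → nth σ j ≡ just l → Fresh l (vertexOf σ j)
      Fresh-nth = FreshWord-nth (proj₁ (IsColPerm⇒FreshWord σ cp))

    module _ (s : sum μ ≡ n) where

      IsMaxChain⇒cbar : ∀ d → IsMaxChainOI n μ d → Σ (Word n) λ σ → IsColPerm n μ σ × cbar μ σ ≡ d
      IsMaxChain⇒cbar d ((inside , linked) , len) with zero⊎suc n
      ... | inj₁ refl with d | len
      ...   | [] | _ = [] , (↭-refl , λ j → sym (at-sum≡0 μ j s)) , refl
      IsMaxChain⇒cbar d ((inside , linked) , len) | inj₂ (m , refl)
        with Between⇒FreshWord (chain⇒Between d (⊥ᵥ<ᵥ⊤ᵥ (s≤s z≤n)) inside linked) IsWeighted-⊥ᵥ (IsWeighted-⊤ᵥ s) rank-top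
        where
        rank-top : rank ⊤ᵥ ≡ suc (length d + rank ⊥ᵥ)
        rank-top = trans rank-⊤ᵥ (cong suc (trans (sym len) (trans (sym (NP.+-identityʳ _)) (cong (length d +_) (sym rank-⊥ᵥ)))))
      ... | ω , f , len-ω , d≡ , ⊤≡ =
        ω , FreshWord⇒IsColPerm ω f (trans (cong (vertexOf ω) len-ω) (sym ⊤≡)) ,
        trans (cbar≡vertexOf ω) (trans (cong (applyUpTo (vertexOf ω ∘ suc)) (sym len)) (sym d≡))

      Splitting : Chain n μ → Set
      Splitting f = Σ (Word n) λ τ → Σ (Word n) λ u → Σ (CLetter n) λ l₁ → Σ (CLetter n) λ l₂ → Σ (Word n) λ v →
                    IsColPerm n μ τ × τ ≡ u ++ l₁ ∷ l₂ ∷ v × f ≡ deleteAt (cbar μ τ) (length u)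

      -- Every codimension-one face lies in a maximal chain c̄(τ); the missing vertex sits between two letters of τ.
      face⇒Splitting : ∀ f → IsChainOI n μ f → length f + 2 ≡ n → Splitting f
      face⇒Splitting f chain len = splitting f chain (trans (NP.+-comm 2 (length f)) len)
        where
        splitting : ∀ f → IsChainOI n μ f → suc (suc (length f)) ≡ n → Splitting f
        splitting f (inside , linked) n≡
          with insert-missing-vertex (chain⇒Between f (⊥ᵥ<ᵥ⊤ᵥ (subst (1 ≤_) n≡ (s≤s z≤n))) inside linked) IsWeighted-⊥ᵥ (IsWeighted-⊤ᵥ s)
                 (trans rank-⊤ᵥ (trans (sym n≡) (cong (suc ∘ suc) (trans (sym (NP.+-identityʳ _)) (cong (length f +_) (sym rank-⊥ᵥ))))))
        ... | vs , p , b , f≡ , p≤ , len-vs with Between⇒chain b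
        ...   | inside′ , linked′ with IsMaxChain⇒cbar vs ((inside′ , linked′) , trans len-vs (cong (_∸ 1) n≡))
        ...     | τ , cp , cbar≡vs
                  with split-at τ p (subst (suc (suc p) ≤_) (trans n≡ (sym (length-colPerm cp))) (s≤s (s≤s p≤)))
        ...       | u , l₁ , l₂ , v , τ≡ , refl =
                    τ , u , l₁ , l₂ , v , cp , τ≡ , trans f≡ (cong (λ c → deleteAt c (length u)) (sym cbar≡vs))


    nth-cbar : ∀ (σ : Word n) q → q < n ∸ 1 → nth (cbar μ σ) q ≡ just (vertexOf σ (suc q))
    nth-cbar σ q q<N = trans (cong (λ c → nth c q) (cbar≡vertexOf σ)) (nth-applyUpTo _ (n ∸ 1) q q<N)

    vertexOf-agree : ∀ {σ ρ} → IsColPerm n μ σ → IsColPerm n μ ρ → ∀ j → j ≤ n →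
      (∀ q → suc q ≡ j → nth (cbar μ σ) q ≡ nth (cbar μ ρ) q) → vertexOf σ j ≡ vertexOf ρ j
    vertexOf-agree cpσ cpρ zero    _   _ = refl
    vertexOf-agree {σ} {ρ} cpσ cpρ (suc q) q<n agree with suc q ℕ.≟ n
    ... | yes refl = trans (vertexOf-n cpσ) (sym (vertexOf-n cpρ))
    ... | no q+1≢n = MaybeP.just-injective
          (trans (sym (nth-cbar σ q (<∸1 q<n q+1≢n))) (trans (agree q refl) (nth-cbar ρ q (<∸1 q<n q+1≢n))))

    -- A letter of a coloured permutation is determined by the two consecutive vertices it joins.
    nth-agree : ∀ {σ ρ} → IsColPerm n μ σ → IsColPerm n μ ρ → ∀ j →
      (j < n → vertexOf σ j ≡ vertexOf ρ j × vertexOf σ (suc j) ≡ vertexOf ρ (suc j)) → nth σ j ≡ nth ρ j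
    nth-agree {σ} {ρ} cpσ cpρ j agree with j ℕ.<? n
    ... | no j≮n = trans (nth-≥length σ j (subst (_≤ j) (sym (length-colPerm cpσ)) (NP.≮⇒≥ j≮n)))
                         (sym (nth-≥length ρ j (subst (_≤ j) (sym (length-colPerm cpρ)) (NP.≮⇒≥ j≮n))))
    ... | yes j<n with nth-<length σ j (subst (j <_) (sym (length-colPerm cpσ)) j<n)
                     | nth-<length ρ j (subst (j <_) (sym (length-colPerm cpρ)) j<n) | agree j<n
    ...   | l , σj≡l | l′ , ρj≡l′ | agree₀ , agree₁ = trans σj≡l (trans (cong just l≡l′) (sym ρj≡l′))
      where
      l≡l′ : l ≡ l′
      l≡l′ = extend-injective l l′ (vertexOf σ j) (Fresh-nth cpσ j l σj≡l) (subst (Fresh l′) (sym agree₀) (Fresh-nth cpρ j l′ ρj≡l′))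
        (begin
          extend l (vertexOf σ j)   ≡⟨ walk-suc ⊥ᵥ σ j l σj≡l ⟨
          vertexOf σ (suc j)        ≡⟨ agree₁ ⟩
          vertexOf ρ (suc j)        ≡⟨ walk-suc ⊥ᵥ ρ j l′ ρj≡l′ ⟩
          extend l′ (vertexOf ρ j)  ≡⟨ cong (extend l′) agree₀ ⟨
          extend l′ (vertexOf σ j)  ∎)
        where open ≡-Reasoning

    cbar-injective : ∀ {σ ρ} → IsColPerm n μ σ → IsColPerm n μ ρ → cbar μ σ ≡ cbar μ ρ → σ ≡ ρ
    cbar-injective {σ} {ρ} cpσ cpρ e = nth-ext λ j → nth-agree cpσ cpρ j λ j<n →
      vertexOf-agree cpσ cpρ j (NP.<⇒≤ j<n) agree , vertexOf-agree cpσ cpρ (suc j) j<n agree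
      where
      agree : ∀ {j} q → suc q ≡ j → nth (cbar μ σ) q ≡ nth (cbar μ ρ) q
      agree q _ = cong (λ c → nth c q) e

    -- At position i the two faces carry vertices of ranks i + 2 and i + 1.
    deleteAt-cbar-≢ : ∀ {σ ρ i t} → IsColPerm n μ σ → IsColPerm n μ ρ → i < t → t < n ∸ 1 →
                      deleteAt (cbar μ σ) i ≢ deleteAt (cbar μ ρ) t
    deleteAt-cbar-≢ {σ} {ρ} {i} {t} cpσ cpρ i<t t<N e = NP.1+n≢n (begin
      suc (suc i)                    ≡⟨ rank-vertexOf cpσ (suc (suc i)) i+2≤n ⟨
      rank (vertexOf σ (suc (suc i))) ≡⟨ cong rank same-vertex ⟩
      rank (vertexOf ρ (suc i))       ≡⟨ rank-vertexOf cpρ (suc i) (NP.≤-trans (NP.n≤1+n _) i+2≤n) ⟩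
      suc i                          ∎)
      where
      open ≡-Reasoning
      i+1<N : suc i < n ∸ 1
      i+1<N = NP.<-≤-trans (s≤s i<t) t<N
      i+2≤n : suc (suc i) ≤ n
      i+2≤n = NP.≤-trans i+1<N (NP.m∸n≤m n 1)
      same-vertex : vertexOf σ (suc (suc i)) ≡ vertexOf ρ (suc i)
      same-vertex = MaybeP.just-injective (begin
        just (vertexOf σ (suc (suc i)))  ≡⟨ nth-cbar σ (suc i) i+1<N ⟨
        nth (cbar μ σ) (suc i)           ≡⟨ nth-deleteAt-≥ (cbar μ σ) i i NP.≤-refl ⟨
        nth (deleteAt (cbar μ σ) i) i    ≡⟨ cong (λ c → nth c i) e ⟩
        nth (deleteAt (cbar μ ρ) t) i    ≡⟨ nth-deleteAt-< (cbar μ ρ) t i i<t ⟩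
        nth (cbar μ ρ) i                 ≡⟨ nth-cbar ρ i (NP.<-trans i<t t<N) ⟩
        just (vertexOf ρ (suc i))        ∎)

    deleteAt-cbar-position : ∀ {σ ρ i t} → IsColPerm n μ σ → IsColPerm n μ ρ → i < n ∸ 1 → t < n ∸ 1 →
                             deleteAt (cbar μ σ) i ≡ deleteAt (cbar μ ρ) t → i ≡ t
    deleteAt-cbar-position {i = i} {t} cpσ cpρ i<N t<N e with NP.<-cmp i t
    ... | tri< i<t _ _ = contradiction₀ (deleteAt-cbar-≢ cpσ cpρ i<t t<N e)
    ... | tri≈ _ i≡t _ = i≡t
    ... | tri> _ _ t<i = contradiction₀ (deleteAt-cbar-≢ cpρ cpσ t<i i<N (sym e))

    vertexOf-++ˡ : ∀ (u w : Word n) j → j ≤ length u → vertexOf (u ++ w) j ≡ walk ⊥ᵥ u j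
    vertexOf-++ˡ u w = walk-++ˡ ⊥ᵥ u w

    vertexOf-infix : ∀ (u v : Word n) l₁ l₂ r →
      vertexOf (u ++ l₁ ∷ l₂ ∷ v) (suc (suc (length u + r))) ≡ walk (extend l₂ (extend l₁ (walk ⊥ᵥ u (length u)))) v r
    vertexOf-infix u v l₁ l₂ r =
      trans (cong (vertexOf (u ++ l₁ ∷ l₂ ∷ v)) (sym (trans (NP.+-suc (length u) (suc r)) (cong suc (NP.+-suc (length u) r)))))
            (walk-++ʳ ⊥ᵥ u (l₁ ∷ l₂ ∷ v) (suc (suc r)))

    vertexOf-Reordering : ∀ (u v : Word n) {x y a b l₁ l₂} → Reordering x y a b l₁ l₂ → ∀ j → j ≢ suc (length u) →
      vertexOf (u ++ l₁ ∷ l₂ ∷ v) j ≡ vertexOf (u ++ (x , a) ∷ (y , b) ∷ v) j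
    vertexOf-Reordering u v {x} {y} {a} {b} {l₁} {l₂} r j j≢t+1 with position (length u) j
    ... | before j<t = trans (vertexOf-++ˡ u _ j (NP.<⇒≤ j<t)) (sym (vertexOf-++ˡ u _ j (NP.<⇒≤ j<t)))
    ... | first      = trans (vertexOf-++ˡ u _ j NP.≤-refl) (sym (vertexOf-++ˡ u _ j NP.≤-refl))
    ... | second     = contradiction₀ (j≢t+1 refl)
    ... | after q    = begin
      vertexOf (u ++ l₁ ∷ l₂ ∷ v) (suc (suc (length u + q)))        ≡⟨ vertexOf-infix u v l₁ l₂ q ⟩
      walk (extend l₂ (extend l₁ (walk ⊥ᵥ u (length u)))) v q         ≡⟨ cong (λ w → walk w v q) (extend²-Reordering r _) ⟩
      walk (extend (y , b) (extend (x , a) (walk ⊥ᵥ u (length u)))) v q ≡⟨ vertexOf-infix u v (x , a) (y , b) q ⟨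
      vertexOf (u ++ (x , a) ∷ (y , b) ∷ v) (suc (suc (length u + q))) ∎
      where open ≡-Reasoning

    -- The maximal chains c̄(σ) through the face obtained from c̄(τ) by deleting the rank-(t+1) vertex.
    module AtFace {τ u v : Word n} {x y : Fin n} {a b : ℕ} (cpτ : IsColPerm n μ τ) (τ≡ : τ ≡ u ++ (x , a) ∷ (y , b) ∷ v) where

      t : ℕ
      t = length u

      F : Chain n μ
      F = deleteAt (cbar μ τ) t

      Reordered : Word n → Set
      Reordered σ = Σ (CLetter n) λ l₁ → Σ (CLetter n) λ l₂ → Reordering x y a b l₁ l₂ × σ ≡ u ++ l₁ ∷ l₂ ∷ v

      nth-τ-first : nth τ t ≡ just (x , a)
      nth-τ-first = trans (cong (λ w → nth w t) τ≡) (nth-infix-first u (x , a) (y , b) v)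

      nth-τ-second : nth τ (suc t) ≡ just (y , b)
      nth-τ-second = trans (cong (λ w → nth w (suc t)) τ≡) (nth-infix-second u (x , a) (y , b) v)

      t+2≤n : suc (suc t) ≤ n
      t+2≤n = subst (suc (suc t) ≤_) (length-colPerm cpτ) (nth-just⇒<length τ (suc t) nth-τ-second)

      t<N : t < n ∸ 1
      t<N = <∸1 (NP.≤-trans (NP.n≤1+n _) t+2≤n) (NP.<⇒≢ t+2≤n)

      x≢y : x ≢ y
      x≢y refl with trans (sym (lookup-⁅x⁆∪p-self x _)) (subst (λ w → lookup (proj₁ w) x ≡ false)
                     (walk-suc ⊥ᵥ τ t (x , a) nth-τ-first) (proj₁ (Fresh-nth cpτ (suc t) (x , b) nth-τ-second)))
      ... | ()

      Reordered⇒deleteAt≡F : ∀ σ → Reordered σ → deleteAt (cbar μ σ) t ≡ F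
      Reordered⇒deleteAt≡F σ (l₁ , l₂ , r , refl) = begin
        deleteAt (cbar μ σ) t                              ≡⟨ cong (λ c → deleteAt c t) (cbar≡vertexOf σ) ⟩
        deleteAt (applyUpTo (vertexOf σ ∘ suc) (n ∸ 1)) t  ≡⟨ deleteAt-applyUpTo-cong _ _ (n ∸ 1) t agree ⟩
        deleteAt (applyUpTo (vertexOf τ ∘ suc) (n ∸ 1)) t  ≡⟨ cong (λ c → deleteAt c t) (cbar≡vertexOf τ) ⟨
        F                                                  ∎
        where
        open ≡-Reasoning
        agree : ∀ q → q ≢ t → vertexOf σ (suc q) ≡ vertexOf τ (suc q)
        agree q q≢t = trans (vertexOf-Reordering u v r (suc q) (q≢t ∘ NP.suc-injective)) (cong (λ w → vertexOf w (suc q)) (sym τ≡))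

      module _ {σ : Word n} (cp : IsColPerm n μ σ) (σ↦F : deleteAt (cbar μ σ) t ≡ F) where

        private
          vertices-agree : ∀ j → j ≤ n → j ≢ suc t → vertexOf σ j ≡ vertexOf τ j
          vertices-agree j j≤n j≢t+1 = vertexOf-agree cp cpτ j j≤n λ q q+1≡j →
            deleteAt-≡⇒nth-≡ (cbar μ σ) (cbar μ τ) t q σ↦F (λ q≡t → j≢t+1 (trans (sym q+1≡j) (cong suc q≡t)))

          letters-agree : ∀ j → j ≢ t → j ≢ suc t → nth σ j ≡ nth τ j
          letters-agree j j≢t j≢t+1 = nth-agree cp cpτ j λ j<n →
            vertices-agree j (NP.<⇒≤ j<n) j≢t+1 , vertices-agree (suc j) j<n (j≢t ∘ NP.suc-injective)

          letter-at : ∀ j → j < n → Σ (CLetter n) λ l → nth σ j ≡ just l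
          letter-at j j<n = nth-<length σ j (subst (j <_) (sym (length-colPerm cp)) j<n)

          l₁ l₂ : CLetter n
          l₁ = proj₁ (letter-at t (NP.≤-trans (NP.n≤1+n _) t+2≤n))
          l₂ = proj₁ (letter-at (suc t) t+2≤n)
          σt≡l₁ : nth σ t ≡ just l₁
          σt≡l₁ = proj₂ (letter-at t (NP.≤-trans (NP.n≤1+n _) t+2≤n))
          σt+1≡l₂ : nth σ (suc t) ≡ just l₂
          σt+1≡l₂ = proj₂ (letter-at (suc t) t+2≤n)

          vertexₜ : vertexOf σ t ≡ vertexOf τ t
          vertexₜ = vertices-agree t (NP.≤-trans (NP.n≤1+n _) (NP.≤-trans (NP.n≤1+n _) t+2≤n)) (NP.1+n≢n ∘ sym)

          two-steps : ∀ {ρ} {m₁ m₂ : CLetter n} → nth ρ t ≡ just m₁ → nth ρ (suc t) ≡ just m₂ →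
                      vertexOf ρ (suc (suc t)) ≡ extend m₂ (extend m₁ (vertexOf ρ t))
          two-steps {ρ} {m₁} {m₂} ρt ρt+1 = trans (walk-suc ⊥ᵥ ρ (suc t) m₂ ρt+1) (cong (extend m₂) (walk-suc ⊥ᵥ ρ t m₁ ρt))

          reordering : Reordering x y a b l₁ l₂
          reordering = extend²≡⇒Reordering (vertexOf τ t)
            (subst (Fresh l₁) vertexₜ (Fresh-nth cp t l₁ σt≡l₁))
            (subst (Fresh l₂) (trans (walk-suc ⊥ᵥ σ t l₁ σt≡l₁) (cong (extend l₁) vertexₜ)) (Fresh-nth cp (suc t) l₂ σt+1≡l₂))
            (begin
              extend l₂ (extend l₁ (vertexOf τ t))               ≡⟨ cong (extend l₂ ∘ extend l₁) vertexₜ ⟨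
              extend l₂ (extend l₁ (vertexOf σ t))               ≡⟨ two-steps σt≡l₁ σt+1≡l₂ ⟨
              vertexOf σ (suc (suc t))                           ≡⟨ vertices-agree (suc (suc t)) t+2≤n (NP.1+n≢n ∘ NP.suc-injective) ⟩
              vertexOf τ (suc (suc t))                           ≡⟨ two-steps nth-τ-first nth-τ-second ⟩
              extend (y , b) (extend (x , a) (vertexOf τ t))     ∎)
            where open ≡-Reasoning

          σ≡ : ∀ j → nth σ j ≡ nth (u ++ l₁ ∷ l₂ ∷ v) j
          σ≡ j with j ℕ.≟ t | j ℕ.≟ suc t
          ... | yes refl | _        = trans σt≡l₁ (sym (nth-infix-first u l₁ l₂ v))
          ... | no _     | yes refl = trans σt+1≡l₂ (sym (nth-infix-second u l₁ l₂ v))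
          ... | no j≢t   | no j≢t+1 = trans (letters-agree j j≢t j≢t+1)
            (trans (cong (λ w → nth w j) τ≡) (nth-infix-outside u v (x , a) (y , b) l₁ l₂ j j≢t j≢t+1))

        deleteAt≡F⇒Reordered : Reordered σ
        deleteAt≡F⇒Reordered = l₁ , l₂ , reordering , nth-ext σ≡

    IsColPerm-Reordering : ∀ (u v : Word n) {x y a b l₁ l₂} → Reordering x y a b l₁ l₂ →
      IsColPerm n μ (u ++ (x , a) ∷ (y , b) ∷ v) → IsColPerm n μ (u ++ l₁ ∷ l₂ ∷ v)
    IsColPerm-Reordering u v r = IsColPerm-infix {μ = μ} u _ _ v (↭-sym (Reordering-letters r)) (sym ∘ Reordering-count r)

    IsColPerm-Reordering⁻ : ∀ (u v : Word n) {x y a b l₁ l₂} → Reordering x y a b l₁ l₂ →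
      IsColPerm n μ (u ++ l₁ ∷ l₂ ∷ v) → IsColPerm n μ (u ++ (x , a) ∷ (y , b) ∷ v)
    IsColPerm-Reordering⁻ u v r = IsColPerm-infix {μ = μ} u _ _ v (Reordering-letters r) (Reordering-count r)

    open ∈Dec (FinP._≟_ {n}) using (_∈?_)
    open UniqueDec (FinP._≟_ {n}) using (unique?)

    isColPerm? : ∀ σ → Dec (IsColPerm n μ σ)
    isColPerm? σ with unique? (letters σ) ×-dec FinP.all? (λ x → x ∈? letters σ) ×-dec All.all? (λ l → proj₂ l ℕ.<? k) σ
                        ×-dec FinP.all? (λ c → count (toℕ c) σ ℕ.≟ lookup (Vec.fromList μ) c)
    ... | yes cp′ = yes (ColPerm′⇒IsColPerm σ cp′)
    ... | no ¬cp′ = no (¬cp′ ∘ IsColPerm⇒ColPerm′ σ)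

    deleteAt-cbar-face : ∀ (u v : Word n) l₁ l₂ → IsColPerm n μ (u ++ l₁ ∷ l₂ ∷ v) →
      IsChainOI n μ (deleteAt (cbar μ (u ++ l₁ ∷ l₂ ∷ v)) (length u)) × length (deleteAt (cbar μ (u ++ l₁ ∷ l₂ ∷ v)) (length u)) + 2 ≡ n
    deleteAt-cbar-face u v l₁ l₂ cp with IsColPerm⇒IsMaxChain _ cp
    ... | (inside , linked) , len =
      (All-deleteAt _ (length u) inside , Linked-deleteAt <ᵥ-trans _ (length u) linked) ,
      (begin
        length (deleteAt c (length u)) + 2  ≡⟨ NP.+-comm _ 2 ⟩
        suc (suc (length (deleteAt c (length u)))) ≡⟨ cong suc (length-deleteAt c (length u) (subst (length u <_) (sym len) t<N)) ⟩
        suc (length c)                       ≡⟨ cong suc len ⟩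
        suc (n ∸ 1)                          ≡⟨ NP.m+[n∸m]≡n {1} {n} 1≤n ⟩
        n                                    ∎)
      where
      open ≡-Reasoning
      c : Chain n μ
      c = cbar μ (u ++ l₁ ∷ l₂ ∷ v)
      open AtFace {u = u} {v} {proj₁ l₁} {proj₁ l₂} {proj₂ l₁} {proj₂ l₂} cp refl using (t<N; t+2≤n)
      1≤n : 1 ≤ n
      1≤n = NP.≤-trans (s≤s z≤n) t+2≤n

  -- The action of 𝔖ₙ

  module Action {n : ℕ} (μ : List ℕ) (π : Permutation′ n) where

    private
      k : ℕ
      k = length μ
      act : CLetter n → CLetter n
      act l = π ⟨$⟩ʳ proj₁ l , proj₂ l

    map-π-allFin : map (π ⟨$⟩ʳ_) (allFin n) ↭ allFin n
    map-π-allFin = Unique∧complete⇒↭allFin _ (UniqueP.map⁺ π-injective (UniqueP.allFin⁺ n))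
      (λ x → subst (_∈ map (π ⟨$⟩ʳ_) (allFin n)) (inverseʳ π) (∈P.∈-map⁺ (π ⟨$⟩ʳ_) (∈P.∈-allFin (π ⟨$⟩ˡ x))))
      where
      π-injective : ∀ {x y} → π ⟨$⟩ʳ x ≡ π ⟨$⟩ʳ y → x ≡ y
      π-injective e = trans (sym (inverseˡ π)) (trans (cong (π ⟨$⟩ˡ_) e) (inverseˡ π))

    count-act : ∀ j σ → count j (map act σ) ≡ count j σ
    count-act j σ = count-colours j (map act σ) σ (sym (ListP.map-∘ σ))

    IsColPerm-act : ∀ σ → IsColPerm n μ σ → IsColPerm n μ (actWord π σ)
    IsColPerm-act σ (p , count≡at) =
      subst (_↭ allFin n) (sym (trans (sym (ListP.map-∘ σ)) (ListP.map-∘ σ))) (↭-trans (↭P.map⁺ (π ⟨$⟩ʳ_) p) map-π-allFin) ,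
      λ j → trans (count-act j σ) (count≡at j)

    lookup-⁅πx⁆ : ∀ x y → lookup ⁅ π ⟨$⟩ʳ x ⁆ y ≡ lookup ⁅ x ⁆ (π ⟨$⟩ˡ y)
    lookup-⁅πx⁆ x y with x FinP.≟ (π ⟨$⟩ˡ y)
    ... | yes refl = trans (cong (lookup ⁅ π ⟨$⟩ʳ (π ⟨$⟩ˡ y) ⁆) (sym (inverseʳ π)))
                           (trans (lookup-⁅x⁆-self (π ⟨$⟩ʳ (π ⟨$⟩ˡ y))) (sym (lookup-⁅x⁆-self (π ⟨$⟩ˡ y))))
    ... | no x≢ = trans (lookup-⁅x⁆-other _ y (λ e → x≢ (trans (sym (inverseˡ π)) (cong (π ⟨$⟩ˡ_) e))))
                        (sym (lookup-⁅x⁆-other x (π ⟨$⟩ˡ y) x≢))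

    set-act : ∀ (xs : Word n) → foldr (λ l B → ⁅ proj₁ l ⁆ ∪ B) Sub.⊥ (map act xs)
                              ≡ tabulate (λ y → lookup (foldr (λ l B → ⁅ proj₁ l ⁆ ∪ B) Sub.⊥ xs) (π ⟨$⟩ˡ y))
    set-act []       = lookup-ext λ y → trans (lookup-⊥ y) (sym (trans (VecP.lookup∘tabulate _ y) (lookup-⊥ (π ⟨$⟩ˡ y))))
    set-act (l ∷ xs) = lookup-ext λ y → begin
      lookup (⁅ π ⟨$⟩ʳ proj₁ l ⁆ ∪ S′) y                    ≡⟨ lookup-∪ ⁅ π ⟨$⟩ʳ proj₁ l ⁆ S′ y ⟩
      lookup ⁅ π ⟨$⟩ʳ proj₁ l ⁆ y ∨ lookup S′ y             ≡⟨ cong₂ _∨_ (lookup-⁅πx⁆ (proj₁ l) y)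
                                                                (trans (cong (λ B → lookup B y) (set-act xs)) (VecP.lookup∘tabulate _ y)) ⟩
      lookup ⁅ proj₁ l ⁆ (π ⟨$⟩ˡ y) ∨ lookup S (π ⟨$⟩ˡ y)   ≡⟨ lookup-∪ ⁅ proj₁ l ⁆ S (π ⟨$⟩ˡ y) ⟨
      lookup (⁅ proj₁ l ⁆ ∪ S) (π ⟨$⟩ˡ y)                  ≡⟨ VecP.lookup∘tabulate _ y ⟨
      lookup (tabulate (λ z → lookup (⁅ proj₁ l ⁆ ∪ S) (π ⟨$⟩ˡ z))) y ∎
      where
      open ≡-Reasoning
      S S′ : Subset n
      S = foldr (λ l B → ⁅ proj₁ l ⁆ ∪ B) Sub.⊥ xs
      S′ = foldr (λ l B → ⁅ proj₁ l ⁆ ∪ B) Sub.⊥ (map act xs)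

    weight-act : ∀ (xs : Word n) → foldr (λ l ν → zipWith _+_ (unitVec k (proj₂ l)) ν) (replicate k 0) (map act xs)
                                 ≡ foldr (λ l ν → zipWith _+_ (unitVec k (proj₂ l)) ν) (replicate k 0) xs
    weight-act []       = refl
    weight-act (l ∷ xs) = cong (zipWith _+_ (unitVec k (proj₂ l))) (weight-act xs)

    cbar-act : ∀ σ → cbar μ (actWord π σ) ≡ map (actVertex π) (cbar μ σ)
    cbar-act σ = trans (ListP.map-cong prefix-act (applyUpTo suc (n ∸ 1))) (ListP.map-∘ (applyUpTo suc (n ∸ 1)))
      where
      prefix-act : ∀ i → prefixVertex μ (actWord π σ) i ≡ actVertex π (prefixVertex μ σ i)
      prefix-act i rewrite ListP.take-map {f = act} i σ = cong₂ _,_ (set-act (take i σ)) (weight-act (take i σ))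
  if-dec-yes : ∀ {a p} {A : Set a} {P : Set p} (d : Dec P) {x y : A} → P → (if ⌊ d ⌋ then x else y) ≡ x
  if-dec-yes (yes _)  p = refl
  if-dec-yes (no ¬p) p = contradiction₀ (¬p p)

  if-dec-no : ∀ {a p} {A : Set a} {P : Set p} (d : Dec P) {x y : A} → ¬ P → (if ⌊ d ⌋ then x else y) ≡ y
  if-dec-no (yes p) ¬p = contradiction₀ (¬p p)
  if-dec-no (no _)  ¬p = refl

-- Cochains over a field

module Cochains {c ℓ} (K : Field c ℓ) where
  open import Data.Bool using (if_then_else_)
  open import Data.Empty using () renaming (⊥-elim to contradiction₀)
  open import Data.Fin using (Fin; toℕ; fromℕ<) renaming (zero to fzero; suc to fsuc)
  import Data.Fin.Properties as FinP
  open import Data.List as List using (length; foldr; removeAt; _++_)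
  open import Data.List.Relation.Unary.All using ([]; _∷_)
  import Data.List.Properties as ListP
  open import Data.Nat as ℕ using (zero; suc; _<_; _∸_)
  import Data.Nat.Properties as NP
  open import Function using (_∘_; id)
  open import Relation.Nullary using (Dec; yes; no; _×-dec_)
  open import Relation.Nullary.Decidable using (⌊_⌋)
  open import Relation.Binary.PropositionalEquality using (_≢_; refl; sym; trans; cong; subst; module ≡-Reasoning)
  open Combinatorics
  open Field K renaming (refl to ≈-refl; sym to ≈-sym; trans to ≈-trans; reflexive to ≈-reflexive)
  open Lin K
  open import Algebra.Properties.Ring ring using (-‿distribˡ-*; -‿distribʳ-*; -‿involutive)

  sgn² : ∀ t → sgn t * sgn t ≈ 1#
  sgn² zero    = *-identityˡ 1#
  sgn² (suc t) = begin
    (- sgn t) * (- sgn t)   ≈⟨ -‿distribˡ-* (sgn t) (- sgn t) ⟨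
    - (sgn t * - sgn t)     ≈⟨ -‿cong (-‿distribʳ-* (sgn t) (sgn t)) ⟨
    - (- (sgn t * sgn t))   ≈⟨ -‿involutive _ ⟩
    sgn t * sgn t           ≈⟨ sgn² t ⟩
    1#                      ∎
    where open import Relation.Binary.Reasoning.Setoid setoid

  module _ {X : Set} (h : X → Carrier) where

    foldr-tabulate-≈0 : ∀ m (g : Fin m → X) → (∀ i → h (g i) ≈ 0#) → foldr (λ x s → h x + s) 0# (List.tabulate g) ≈ 0#
    foldr-tabulate-≈0 zero    g h≈0 = ≈-refl
    foldr-tabulate-≈0 (suc m) g h≈0 =
      ≈-trans (+-cong (h≈0 fzero) (foldr-tabulate-≈0 m (g ∘ fsuc) (h≈0 ∘ fsuc))) (+-identityˡ 0#)

    foldr-tabulate-single : ∀ m (g : Fin m → X) i₀ → (∀ i → i ≢ i₀ → h (g i) ≈ 0#) →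
                            foldr (λ x s → h x + s) 0# (List.tabulate g) ≈ h (g i₀)
    foldr-tabulate-single (suc m) g fzero     h≈0 =
      ≈-trans (+-cong ≈-refl (foldr-tabulate-≈0 m (g ∘ fsuc) (λ i → h≈0 (fsuc i) λ ()))) (+-identityʳ _)
    foldr-tabulate-single (suc m) g (fsuc i₀) h≈0 =
      ≈-trans (+-cong (h≈0 fzero λ ())
                      (foldr-tabulate-single m (g ∘ fsuc) i₀ (λ i i≢ → h≈0 (fsuc i) (i≢ ∘ FinP.suc-injective))))
              (+-identityˡ _)

  module _ (n : ℕ) (μ : List ℕ) where

    private
      term : Chain n μ → (d : Chain n μ) → Fin (length d) → Carrier
      term c d i = if ⌊ chain-≟ n μ (removeAt d i) c ⌋ then sgn (toℕ i) else 0#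

    cobdry-none : ∀ c d → (IsChainOI n μ d → ∀ i → removeAt d i ≢ c) → cobdry n μ c d ≈ 0#
    cobdry-none c d never with isChainOI? n μ d
    ... | no  _     = ≈-refl
    ... | yes chain = foldr-tabulate-≈0 (term c d) (length d) id λ i → ≈-reflexive (if-dec-no (chain-≟ n μ (removeAt d i) c) (never chain i))

    cobdry-single : ∀ c d t → IsChainOI n μ d → (t<d : t < length d) → deleteAt d t ≡ c →
                    (∀ i → removeAt d i ≡ c → toℕ i ≡ t) → cobdry n μ c d ≈ sgn t
    cobdry-single c d t chain t<d at-t only-t with isChainOI? n μ d
    ... | no ¬chain = contradiction₀ (¬chain chain)
    ... | yes _ = ≈-trans (foldr-tabulate-single (term c d) (length d) id i₀ off-t)
                          (≈-reflexive (trans (if-dec-yes (chain-≟ n μ (removeAt d i₀) c) removed≡c) (cong sgn (FinP.toℕ-fromℕ< t<d))))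
      where
      i₀ : Fin (length d)
      i₀ = fromℕ< t<d
      removed≡c : removeAt d i₀ ≡ c
      removed≡c = trans (removeAt≡deleteAt d i₀) (trans (cong (deleteAt d) (FinP.toℕ-fromℕ< t<d)) at-t)
      off-t : ∀ i → i ≢ i₀ → term c d i ≈ 0#
      off-t i i≢i₀ = ≈-reflexive (if-dec-no (chain-≟ n μ (removeAt d i) c)
        (λ e → i≢i₀ (FinP.toℕ-injective (trans (only-t i e) (sym (FinP.toℕ-fromℕ< t<d))))))

    cobdry-nonmax : ∀ c → length c ℕ.+ 2 ≡ n → ∀ d → ¬ IsMaxChainOI n μ d → cobdry n μ c d ≈ 0#
    cobdry-nonmax c len d ¬max = cobdry-none c d λ chain i removed≡c → ¬max (chain , length-d i removed≡c)
      where
      length-d : ∀ i → removeAt d i ≡ c → length d ≡ n ∸ 1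
      length-d i e = begin
        length d                              ≡⟨ length-deleteAt d (toℕ i) (FinP.toℕ<n i) ⟨
        suc (length (deleteAt d (toℕ i)))     ≡⟨ cong (suc ∘ length) (trans (sym (removeAt≡deleteAt d i)) e) ⟩
        suc (length c)                        ≡⟨ cong (_∸ 1) (trans (NP.+-comm 2 (length c)) len) ⟩
        n ∸ 1                                 ∎
        where open ≡-Reasoning

  ≈-rescale : ∀ {p} {P : Set p} {A B m s : Carrier} → Dec P → (P → A ≈ m) → (¬ P → A ≈ 0#) →
              (P → B ≈ s) → (¬ P → B ≈ 0#) → s * s ≈ 1# → A ≈ (m * s) * B
  ≈-rescale {A = A} {B} {m} {s} (yes p) A-yes _ B-yes _ s²≈1 = begin
    A                ≈⟨ A-yes p ⟩
    m                ≈⟨ *-identityʳ m ⟨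
    m * 1#           ≈⟨ *-cong ≈-refl s²≈1 ⟨
    m * (s * s)      ≈⟨ *-assoc m s s ⟨
    (m * s) * s      ≈⟨ *-cong ≈-refl (B-yes p) ⟨
    (m * s) * B      ∎
    where open import Relation.Binary.Reasoning.Setoid setoid
  ≈-rescale {m = m} {s} (no ¬p) _ A-no _ B-no _ =
    ≈-trans (A-no ¬p) (≈-trans (≈-sym (zeroʳ (m * s))) (*-cong ≈-refl (≈-sym (B-no ¬p))))

  ≈-rescale⁻ : ∀ {p} {P : Set p} {A B s : Carrier} → Dec P → (P → A ≈ 1#) → (¬ P → A ≈ 0#) →
               (P → B ≈ s) → (¬ P → B ≈ 0#) → B ≈ s * A
  ≈-rescale⁻ {s = s} (yes p) A-yes _ B-yes _ =
    ≈-trans (B-yes p) (≈-trans (≈-sym (*-identityʳ s)) (*-cong ≈-refl (≈-sym (A-yes p))))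
  ≈-rescale⁻ {s = s} (no ¬p) _ A-no _ B-no =
    ≈-trans (B-no ¬p) (≈-trans (≈-sym (zeroʳ s)) (*-cong ≈-refl (≈-sym (A-no ¬p))))

  -- Coefficients of the ideal generators at a word: the terms are 0# and 1#.
  sum₂ : Carrier → Carrier → Carrier
  sum₂ p q = p + (q + 0#)

  sum₄ : Carrier → Carrier → Carrier → Carrier → Carrier
  sum₄ p q r s = p + (q + (r + (s + 0#)))

  sum₂-≡ : ∀ {p q p′ q′} → p ≡ p′ → q ≡ q′ → sum₂ p q ≡ sum₂ p′ q′
  sum₂-≡ refl refl = refl

  sum₄-≡ : ∀ {p q r s p′ q′ r′ s′} → p ≡ p′ → q ≡ q′ → r ≡ r′ → s ≡ s′ → sum₄ p q r s ≡ sum₄ p′ q′ r′ s′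
  sum₄-≡ refl refl refl refl = refl

  private
    0+ : ∀ x → 0# + x ≈ x
    0+ = +-identityˡ
    +0 : ∀ x → x + 0# ≈ x
    +0 = +-identityʳ

  sum₂-10 : sum₂ 1# 0# ≈ 1#
  sum₂-10 = ≈-trans (+-cong ≈-refl (0+ _)) (+0 _)
  sum₂-01 : sum₂ 0# 1# ≈ 1#
  sum₂-01 = ≈-trans (0+ _) (+0 _)
  sum₂-00 : sum₂ 0# 0# ≈ 0#
  sum₂-00 = ≈-trans (0+ _) (0+ _)

  sum₄-1000 : sum₄ 1# 0# 0# 0# ≈ 1#
  sum₄-1000 = ≈-trans (+-cong ≈-refl (≈-trans (0+ _) (≈-trans (0+ _) (0+ _)))) (+0 _)
  sum₄-0100 : sum₄ 0# 1# 0# 0# ≈ 1#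
  sum₄-0100 = ≈-trans (0+ _) (≈-trans (+-cong ≈-refl (≈-trans (0+ _) (0+ _))) (+0 _))
  sum₄-0010 : sum₄ 0# 0# 1# 0# ≈ 1#
  sum₄-0010 = ≈-trans (0+ _) (≈-trans (0+ _) (≈-trans (+-cong ≈-refl (0+ _)) (+0 _)))
  sum₄-0001 : sum₄ 0# 0# 0# 1# ≈ 1#
  sum₄-0001 = ≈-trans (0+ _) (≈-trans (0+ _) (≈-trans (0+ _) (+0 _)))
  sum₄-0000 : sum₄ 0# 0# 0# 0# ≈ 0#
  sum₄-0000 = ≈-trans (0+ _) (≈-trans (0+ _) (≈-trans (0+ _) (0+ _)))
  sum₄-1001 : sum₄ 1# 0# 0# 1# ≈ 1# + 1#
  sum₄-1001 = +-cong ≈-refl (≈-trans (0+ _) (≈-trans (0+ _) (+0 _)))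
  sum₄-0110 : sum₄ 0# 1# 1# 0# ≈ 1# + 1#
  sum₄-0110 = ≈-trans (0+ _) (+-cong ≈-refl (≈-trans (+-cong ≈-refl (0+ _)) (+0 _)))

  module Faces (n : ℕ) (μ : List ℕ) where
    open Colourings n μ

    [_≟_] : Word n → Word n → Carrier
    [ w ≟ σ ] = if ⌊ word-≟ w σ ⌋ then 1# else 0#

    module AtFaceᴷ {τ u v : Word n} {x y : Fin n} {a b : ℕ} (cpτ : IsColPerm n μ τ) (τ≡ : τ ≡ u ++ (x , a) ∷ (y , b) ∷ v) where
      open AtFace cpτ τ≡ public

      removeAt-cbar≡F⇒ : ∀ {σ} → IsColPerm n μ σ → ∀ i → removeAt (cbar μ σ) i ≡ F → deleteAt (cbar μ σ) t ≡ F
      removeAt-cbar≡F⇒ {σ} cp i e = subst (λ q → deleteAt (cbar μ σ) q ≡ F) (deleteAt-cbar-position cp cpτ (toℕ<n∸1 σ i) t<N e′) e′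
        where
        e′ : deleteAt (cbar μ σ) (toℕ i) ≡ F
        e′ = trans (sym (removeAt≡deleteAt (cbar μ σ) i)) e

      δF-Reordered : ∀ {σ} → IsColPerm n μ σ → Reordered σ → cobdry n μ F (cbar μ σ) ≈ sgn t
      δF-Reordered {σ} cp r =
        cobdry-single n μ F (cbar μ σ) t (proj₁ (IsColPerm⇒IsMaxChain σ cp)) (subst (t <_) (sym (length-cbar σ)) t<N)
          (Reordered⇒deleteAt≡F σ r)
          λ i e → deleteAt-cbar-position cp cpτ (toℕ<n∸1 σ i) t<N (trans (sym (removeAt≡deleteAt (cbar μ σ) i)) e)

      δF-¬Reordered : ∀ {σ} → IsColPerm n μ σ → ¬ Reordered σ → cobdry n μ F (cbar μ σ) ≈ 0#
      δF-¬Reordered {σ} cp ¬r = cobdry-none n μ F (cbar μ σ) λ _ i e → ¬r (deleteAt≡F⇒Reordered cp (removeAt-cbar≡F⇒ cp i e))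

      word : CLetter n → CLetter n → Word n
      word l₁ l₂ = u ++ l₁ ∷ l₂ ∷ v

      Reordered? : ∀ σ → Dec (Reordered σ)
      Reordered? σ with word-≟ σ (word (x , a) (y , b)) | word-≟ σ (word (y , a) (x , b))
                      | word-≟ σ (word (y , b) (x , a)) | word-≟ σ (word (x , b) (y , a))
      ... | yes e | _     | _     | _     = yes (_ , _ , ⟨xa,yb⟩ , e)
      ... | no _  | yes e | _     | _     = yes (_ , _ , ⟨ya,xb⟩ , e)
      ... | no _  | no _  | yes e | _     = yes (_ , _ , ⟨yb,xa⟩ , e)
      ... | no _  | no _  | no _  | yes e = yes (_ , _ , ⟨xb,ya⟩ , e)
      ... | no ¬₁ | no ¬₂ | no ¬₃ | no ¬₄ = no λ
        { (_ , _ , ⟨xa,yb⟩ , e) → ¬₁ e ; (_ , _ , ⟨ya,xb⟩ , e) → ¬₂ e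
        ; (_ , _ , ⟨yb,xa⟩ , e) → ¬₃ e ; (_ , _ , ⟨xb,ya⟩ , e) → ¬₄ e }

      Reordered-IsColPerm : ∀ σ → Reordered σ → IsColPerm n μ σ
      Reordered-IsColPerm σ (_ , _ , r , refl) = IsColPerm-Reordering u v r (subst (IsColPerm n μ) τ≡ cpτ)

      [word≟]-yes : ∀ {l₁ l₂} → [ word l₁ l₂ ≟ word l₁ l₂ ] ≡ 1#
      [word≟]-yes {l₁} {l₂} = if-dec-yes (word-≟ (word l₁ l₂) (word l₁ l₂)) refl

      [word≟]-no : ∀ {l₁ l₂ m₁ m₂} → l₁ ≢ m₁ → [ word l₁ l₂ ≟ word m₁ m₂ ] ≡ 0#
      [word≟]-no {l₁} {l₂} {m₁} {m₂} l₁≢m₁ =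
        if-dec-no (word-≟ (word l₁ l₂) (word m₁ m₂)) (l₁≢m₁ ∘ proj₁ ∘ ListP.∷-injective ∘ ListP.++-cancelˡ u (l₁ ∷ l₂ ∷ v) (m₁ ∷ m₂ ∷ v))

      [word≟]-¬Reordered : ∀ {σ l₁ l₂} → Reordering x y a b l₁ l₂ → ¬ Reordered σ → [ word l₁ l₂ ≟ σ ] ≡ 0#
      [word≟]-¬Reordered {σ} {l₁} {l₂} r ¬r = if-dec-no (word-≟ (word l₁ l₂) σ) (λ e → ¬r (l₁ , l₂ , r , sym e))

      x≢y′ : ∀ {c d : ℕ} → (x , c) ≢ (y , d)
      x≢y′ e = x≢y (cong proj₁ e)

      y≢x′ : ∀ {c d : ℕ} → (y , c) ≢ (x , d)
      y≢x′ e = x≢y (sym (cong proj₁ e))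

      coeff-gen₂ : a ≢ b → ∀ σ → Reordered σ → coeff word-≟ (igen (gen₂ u v x y a b)) σ ≈ 1#
      coeff-gen₂ a≢b σ (_ , _ , ⟨xa,yb⟩ , refl) = ≈-trans (≈-reflexive
        (sum₄-≡ [word≟]-yes ([word≟]-no y≢x′) ([word≟]-no y≢x′) ([word≟]-no (a≢b ∘ sym ∘ cong proj₂)))) sum₄-1000
      coeff-gen₂ a≢b σ (_ , _ , ⟨ya,xb⟩ , refl) = ≈-trans (≈-reflexive
        (sum₄-≡ ([word≟]-no x≢y′) [word≟]-yes ([word≟]-no (a≢b ∘ sym ∘ cong proj₂)) ([word≟]-no x≢y′))) sum₄-0100
      coeff-gen₂ a≢b σ (_ , _ , ⟨yb,xa⟩ , refl) = ≈-trans (≈-reflexive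
        (sum₄-≡ ([word≟]-no x≢y′) ([word≟]-no (a≢b ∘ cong proj₂)) [word≟]-yes ([word≟]-no x≢y′))) sum₄-0010
      coeff-gen₂ a≢b σ (_ , _ , ⟨xb,ya⟩ , refl) = ≈-trans (≈-reflexive
        (sum₄-≡ ([word≟]-no (a≢b ∘ cong proj₂)) ([word≟]-no y≢x′) ([word≟]-no y≢x′) [word≟]-yes)) sum₄-0001

      -- When a = b the four words of the generator coincide in pairs.
      coeff-gen₂-diagonal : a ≡ b → ∀ σ → Reordered σ → coeff word-≟ (igen (gen₂ u v x y a b)) σ ≈ 1# + 1#
      coeff-gen₂-diagonal refl σ (_ , _ , ⟨xa,yb⟩ , refl) = ≈-trans (≈-reflexive
        (sum₄-≡ [word≟]-yes ([word≟]-no y≢x′) ([word≟]-no y≢x′) [word≟]-yes)) sum₄-1001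
      coeff-gen₂-diagonal refl σ (_ , _ , ⟨ya,xb⟩ , refl) = ≈-trans (≈-reflexive
        (sum₄-≡ ([word≟]-no x≢y′) [word≟]-yes [word≟]-yes ([word≟]-no x≢y′))) sum₄-0110
      coeff-gen₂-diagonal refl σ (_ , _ , ⟨yb,xa⟩ , refl) = ≈-trans (≈-reflexive
        (sum₄-≡ ([word≟]-no x≢y′) [word≟]-yes [word≟]-yes ([word≟]-no x≢y′))) sum₄-0110
      coeff-gen₂-diagonal refl σ (_ , _ , ⟨xb,ya⟩ , refl) = ≈-trans (≈-reflexive
        (sum₄-≡ [word≟]-yes ([word≟]-no y≢x′) ([word≟]-no y≢x′) [word≟]-yes)) sum₄-1001

      coeff-gen₂-¬Reordered : ∀ σ → ¬ Reordered σ → coeff word-≟ (igen (gen₂ u v x y a b)) σ ≈ 0#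
      coeff-gen₂-¬Reordered σ ¬r = ≈-trans (≈-reflexive (sum₄-≡
        ([word≟]-¬Reordered ⟨xa,yb⟩ ¬r) ([word≟]-¬Reordered ⟨ya,xb⟩ ¬r) ([word≟]-¬Reordered ⟨yb,xa⟩ ¬r) ([word≟]-¬Reordered ⟨xb,ya⟩ ¬r)))
        sum₄-0000

      coeff-gen₁ : a ≡ b → ∀ σ → Reordered σ → coeff word-≟ (igen (gen₁ u v x y a)) σ ≈ 1#
      coeff-gen₁ refl σ (_ , _ , ⟨xa,yb⟩ , refl) =
        ≈-trans (≈-reflexive (sum₂-≡ [word≟]-yes ([word≟]-no y≢x′))) sum₂-10
      coeff-gen₁ refl σ (_ , _ , ⟨ya,xb⟩ , refl) =
        ≈-trans (≈-reflexive (sum₂-≡ ([word≟]-no x≢y′) [word≟]-yes)) sum₂-01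
      coeff-gen₁ refl σ (_ , _ , ⟨yb,xa⟩ , refl) =
        ≈-trans (≈-reflexive (sum₂-≡ ([word≟]-no x≢y′) [word≟]-yes)) sum₂-01
      coeff-gen₁ refl σ (_ , _ , ⟨xb,ya⟩ , refl) =
        ≈-trans (≈-reflexive (sum₂-≡ [word≟]-yes ([word≟]-no y≢x′))) sum₂-10

      coeff-gen₁-¬Reordered : a ≡ b → ∀ σ → ¬ Reordered σ → coeff word-≟ (igen (gen₁ u v x y a)) σ ≈ 0#
      coeff-gen₁-¬Reordered refl σ ¬r = ≈-trans (≈-reflexive (sum₂-≡
        ([word≟]-¬Reordered ⟨xa,yb⟩ ¬r) ([word≟]-¬Reordered ⟨ya,xb⟩ ¬r))) sum₂-00

  module Isomorphism (n : ℕ) (μ : List ℕ) (s : sum μ ≡ n) where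
    open Colourings n μ
    open Faces n μ

    ColPermSum : FormalSum (Word n) → Set c
    ColPermSum L = All (λ p → IsColPerm n μ (proj₂ p)) L

    φ : FormalSum (Word n) → FormalSum (Chain n μ)
    φ = map (λ p → proj₁ p , cbar μ (proj₂ p))

    coeff-φ : ∀ L → ColPermSum L → ∀ σ → IsColPerm n μ σ → coeff (chain-≟ n μ) (φ L) (cbar μ σ) ≈ coeff word-≟ L σ
    coeff-φ []            _           σ cp = ≈-refl
    coeff-φ ((α , w) ∷ L) (cpw ∷ cps) σ cp = +-cong (≈-reflexive term) (coeff-φ L cps σ cp)
      where
      term : (if ⌊ chain-≟ n μ (cbar μ w) (cbar μ σ) ⌋ then α else 0#) ≡ (if ⌊ word-≟ w σ ⌋ then α else 0#)
      term with word-≟ w σ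
      ... | yes w≡σ = if-dec-yes (chain-≟ n μ (cbar μ w) (cbar μ σ)) (cong (cbar μ) w≡σ)
      ... | no  w≢σ = if-dec-no (chain-≟ n μ (cbar μ w) (cbar μ σ)) (w≢σ ∘ cbar-injective cpw cp)

    coeff-φ-nonmax : ∀ L → ColPermSum L → ∀ d → ¬ IsMaxChainOI n μ d → coeff (chain-≟ n μ) (φ L) d ≈ 0#
    coeff-φ-nonmax []            _           d ¬max = ≈-refl
    coeff-φ-nonmax ((α , w) ∷ L) (cpw ∷ cps) d ¬max = ≈-trans
      (+-cong (≈-reflexive (if-dec-no (chain-≟ n μ (cbar μ w) d) (λ e → ¬max (subst (IsMaxChainOI n μ) e (IsColPerm⇒IsMaxChain w cpw)))))
              (coeff-φ-nonmax L cps d ¬max))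
      (+-identityˡ 0#)

    coeff-nonColPerm : ∀ L → ColPermSum L → ∀ w → ¬ IsColPerm n μ w → coeff word-≟ L w ≈ 0#
    coeff-nonColPerm []             _           w ¬cp = ≈-refl
    coeff-nonColPerm ((α , w′) ∷ L) (cpw ∷ cps) w ¬cp = ≈-trans
      (+-cong (≈-reflexive (if-dec-no (word-≟ w′ w) (λ e → ¬cp (subst (IsColPerm n μ) e cpw)))) (coeff-nonColPerm L cps w ¬cp))
      (+-identityˡ 0#)

    δ : FormalSum (Face₋ n μ) → Chain n μ → Carrier
    δ = lincomb (λ f → cobdry n μ (proj₁ f))

    idealSum : FormalSum (IGen n) → Word n → Carrier
    idealSum = lincomb (λ g → coeff word-≟ (igen g))

    δ-nonmax : ∀ Fs d → ¬ IsMaxChainOI n μ d → δ Fs d ≈ 0#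
    δ-nonmax []                    d ¬max = ≈-refl
    δ-nonmax ((α , f , _ , len) ∷ Fs) d ¬max =
      ≈-trans (+-cong (≈-trans (*-cong ≈-refl (cobdry-nonmax n μ f len d ¬max)) (zeroʳ α)) (δ-nonmax Fs d ¬max)) (+-identityˡ 0#)

    firstWord : IGen n → Word n
    firstWord (gen₁ u v x y i)   = u ++ (x , i) ∷ (y , i) ∷ v
    firstWord (gen₂ u v x y i j) = u ++ (x , i) ∷ (y , j) ∷ v

    generatorFace : ∀ g → IsColPerm n μ (firstWord g) → Face₋ n μ
    generatorFace (gen₁ u v x y i)   cp = _ , deleteAt-cbar-face u v (x , i) (y , i) cp
    generatorFace (gen₂ u v x y i j) cp = _ , deleteAt-cbar-face u v (x , i) (y , j) cp

    -- Coefficient of the face in φ(g): the number of times each word occurs in g, times the sign.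
    faceWeight : IGen n → Carrier
    faceWeight (gen₁ u _ _ _ _)   = sgn (length u)
    faceWeight (gen₂ u _ _ _ i j) with i ℕ.≟ j
    ... | yes _ = (1# + 1#) * sgn (length u)
    ... | no  _ = sgn (length u)

    coeff-generator : ∀ g (cp : IsColPerm n μ (firstWord g)) σ → IsColPerm n μ σ →
                      coeff word-≟ (igen g) σ ≈ faceWeight g * cobdry n μ (proj₁ (generatorFace g cp)) (cbar μ σ)
    coeff-generator (gen₁ u v x y i) cp σ cpσ =
      ≈-trans (≈-rescale (Reordered? σ) (coeff-gen₁ refl σ) (coeff-gen₁-¬Reordered refl σ) (δF-Reordered cpσ) (δF-¬Reordered cpσ) (sgn² t))
              (*-cong (*-identityˡ _) ≈-refl)
      where open AtFaceᴷ cp refl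
    coeff-generator (gen₂ u v x y i j) cp σ cpσ with i ℕ.≟ j
    ... | yes i≡j = ≈-rescale (Reordered? σ) (coeff-gen₂-diagonal i≡j σ) (coeff-gen₂-¬Reordered σ)
                              (δF-Reordered cpσ) (δF-¬Reordered cpσ) (sgn² t)
      where open AtFaceᴷ cp refl
    ... | no  i≢j = ≈-trans (≈-rescale (Reordered? σ) (coeff-gen₂ i≢j σ) (coeff-gen₂-¬Reordered σ)
                                         (δF-Reordered cpσ) (δF-¬Reordered cpσ) (sgn² t))
                              (*-cong (*-identityˡ _) ≈-refl)
      where open AtFaceᴷ cp refl

    coeff-generator-nonColPerm : ∀ g → ¬ IsColPerm n μ (firstWord g) → ∀ σ → IsColPerm n μ σ → coeff word-≟ (igen g) σ ≈ 0#
    coeff-generator-nonColPerm (gen₁ u v x y i) ¬cp σ cpσ =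
      ≈-trans (≈-reflexive (sum₂-≡ (absent ⟨xa,yb⟩) (absent ⟨ya,xb⟩))) sum₂-00
      where
      absent : ∀ {l₁ l₂} → Reordering x y i i l₁ l₂ → [ u ++ l₁ ∷ l₂ ∷ v ≟ σ ] ≡ 0#
      absent r = if-dec-no (word-≟ _ σ) (λ e → ¬cp (IsColPerm-Reordering⁻ u v r (subst (IsColPerm n μ) (sym e) cpσ)))
    coeff-generator-nonColPerm (gen₂ u v x y i j) ¬cp σ cpσ =
      ≈-trans (≈-reflexive (sum₄-≡ (absent ⟨xa,yb⟩) (absent ⟨ya,xb⟩) (absent ⟨yb,xa⟩) (absent ⟨xb,ya⟩))) sum₄-0000
      where
      absent : ∀ {l₁ l₂} → Reordering x y i j l₁ l₂ → [ u ++ l₁ ∷ l₂ ∷ v ≟ σ ] ≡ 0#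
      absent r = if-dec-no (word-≟ _ σ) (λ e → ¬cp (IsColPerm-Reordering⁻ u v r (subst (IsColPerm n μ) (sym e) cpσ)))

    generatorsToFaces : FormalSum (IGen n) → FormalSum (Face₋ n μ)
    generatorsToFaces []             = []
    generatorsToFaces ((α , g) ∷ Gs) with isColPerm? (firstWord g)
    ... | yes cp = (α * faceWeight g , generatorFace g cp) ∷ generatorsToFaces Gs
    ... | no  _  = generatorsToFaces Gs

    idealSum≈δ : ∀ Gs σ → IsColPerm n μ σ → idealSum Gs σ ≈ δ (generatorsToFaces Gs) (cbar μ σ)
    idealSum≈δ []             σ cp = ≈-refl
    idealSum≈δ ((α , g) ∷ Gs) σ cp with isColPerm? (firstWord g)
    ... | yes cpg = +-cong (≈-trans (*-cong ≈-refl (coeff-generator g cpg σ cp)) (≈-sym (*-assoc α _ _))) (idealSum≈δ Gs σ cp)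
    ... | no ¬cpg = ≈-trans (+-cong (≈-trans (*-cong ≈-refl (coeff-generator-nonColPerm g ¬cpg σ cp)) (zeroʳ α)) (idealSum≈δ Gs σ cp))
                            (+-identityˡ _)

    isMaxChain? : ∀ d → Dec (IsMaxChainOI n μ d)
    isMaxChain? d = isChainOI? n μ d ×-dec (length d ℕ.≟ n ∸ 1)

    InI⇒InImδ : ∀ L → ColPermSum L → InI L → InImδ n μ (φ L)
    InI⇒InImδ L cps (Gs , L≈) = generatorsToFaces Gs , φL≈
      where
      φL≈ : ∀ d → coeff (chain-≟ n μ) (φ L) d ≈ δ (generatorsToFaces Gs) d
      φL≈ d with isMaxChain? d
      ... | no ¬max = ≈-trans (coeff-φ-nonmax L cps d ¬max) (≈-sym (δ-nonmax (generatorsToFaces Gs) d ¬max))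
      ... | yes max with IsMaxChain⇒cbar s d max
      ...   | σ , cp , refl = ≈-trans (coeff-φ L cps σ cp) (≈-trans (L≈ σ) (idealSum≈δ Gs σ cp))

    splittingGenerator : ∀ {f} → Splitting s f → Carrier × IGen n
    splittingGenerator (_ , u , (x , a) , (y , b) , v , _) with a ℕ.≟ b
    ... | yes _ = sgn (length u) , gen₁ u v x y a
    ... | no  _ = sgn (length u) , gen₂ u v x y a b

    CoboundaryIsGenerator : Chain n μ → Carrier × IGen n → Set ℓ
    CoboundaryIsGenerator f (β , g) =
      (∀ w → IsColPerm n μ w → cobdry n μ f (cbar μ w) ≈ β * coeff word-≟ (igen g) w)
      × (∀ w → ¬ IsColPerm n μ w → coeff word-≟ (igen g) w ≈ 0#)

    splittingGenerator-spec : ∀ {f} (sp : Splitting s f) → CoboundaryIsGenerator f (splittingGenerator sp)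
    splittingGenerator-spec {f} (τ , u , (x , a) , (y , b) , v , cpτ , τ≡ , refl) with a ℕ.≟ b
    ... | yes a≡b = (λ w cpw → ≈-rescale⁻ (Reordered? w) (coeff-gen₁ a≡b w) (coeff-gen₁-¬Reordered a≡b w)
                                            (δF-Reordered cpw) (δF-¬Reordered cpw)) ,
                    (λ w ¬cp → coeff-gen₁-¬Reordered a≡b w (¬cp ∘ Reordered-IsColPerm w))
      where open AtFaceᴷ cpτ τ≡
    ... | no  a≢b = (λ w cpw → ≈-rescale⁻ (Reordered? w) (coeff-gen₂ a≢b w) (coeff-gen₂-¬Reordered w)
                                            (δF-Reordered cpw) (δF-¬Reordered cpw)) ,
                    (λ w ¬cp → coeff-gen₂-¬Reordered w (¬cp ∘ Reordered-IsColPerm w))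
      where open AtFaceᴷ cpτ τ≡

    faceGenerator : Face₋ n μ → Carrier × IGen n
    faceGenerator (f , chain , len) = splittingGenerator (face⇒Splitting s f chain len)

    faceGenerator-spec : ∀ F → CoboundaryIsGenerator (proj₁ F) (faceGenerator F)
    faceGenerator-spec (f , chain , len) = splittingGenerator-spec (face⇒Splitting s f chain len)

    facesToGenerators : FormalSum (Face₋ n μ) → FormalSum (IGen n)
    facesToGenerators []             = []
    facesToGenerators ((β , F) ∷ Fs) = (β * proj₁ (faceGenerator F) , proj₂ (faceGenerator F)) ∷ facesToGenerators Fs

    δ≈idealSum : ∀ Fs w → IsColPerm n μ w → δ Fs (cbar μ w) ≈ idealSum (facesToGenerators Fs) w
    δ≈idealSum []             w cp = ≈-refl
    δ≈idealSum ((β , F) ∷ Fs) w cp =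
      +-cong (≈-trans (*-cong ≈-refl (proj₁ (faceGenerator-spec F) w cp)) (≈-sym (*-assoc β _ _))) (δ≈idealSum Fs w cp)

    idealSum-nonColPerm : ∀ Fs w → ¬ IsColPerm n μ w → idealSum (facesToGenerators Fs) w ≈ 0#
    idealSum-nonColPerm []             w ¬cp = ≈-refl
    idealSum-nonColPerm ((β , F) ∷ Fs) w ¬cp = ≈-trans
      (+-cong (≈-trans (*-cong ≈-refl (proj₂ (faceGenerator-spec F) w ¬cp)) (zeroʳ _)) (idealSum-nonColPerm Fs w ¬cp))
      (+-identityˡ 0#)

    InImδ⇒InI : ∀ L → ColPermSum L → InImδ n μ (φ L) → InI L
    InImδ⇒InI L cps (Fs , φL≈) = facesToGenerators Fs , L≈
      where
      L≈ : ∀ w → coeff word-≟ L w ≈ idealSum (facesToGenerators Fs) w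
      L≈ w with isColPerm? w
      ... | yes cp  = ≈-trans (≈-sym (coeff-φ L cps w cp)) (≈-trans (φL≈ (cbar μ w)) (δ≈idealSum Fs w cp))
      ... | no  ¬cp = ≈-trans (coeff-nonColPerm L cps w ¬cp) (≈-sym (idealSum-nonColPerm Fs w ¬cp))

    surjective : ∀ d → IsMaxChainOI n μ d →
      ∃ λ (L : FormalSum (Word n)) → ColPermSum L × InImδ n μ ((1# , d) ∷ map (λ p → - proj₁ p , cbar μ (proj₂ p)) L)
    surjective d max with IsMaxChain⇒cbar s d max
    ... | σ , cp , refl = ((1# , σ) ∷ []) , (cp ∷ []) , ([] , cancel)
      where
      cancel : ∀ e → coeff (chain-≟ n μ) ((1# , cbar μ σ) ∷ (- 1# , cbar μ σ) ∷ []) e ≈ 0#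
      cancel e with chain-≟ n μ (cbar μ σ) e
      ... | yes _ = ≈-trans (+-cong ≈-refl (+-identityʳ _)) (-‿inverseʳ 1#)
      ... | no  _ = ≈-trans (+-identityˡ _) (+-identityˡ _)

theorem2p1 : ∀ {c ℓ} (K : Field c ℓ) →
    let open Field K
        open Lin K
    in ¬ (1# + 1# ≈ 0#) →
       (n : ℕ) (μ : List ℕ) → sum μ ≡ n →
       -- φ is well defined and injective:
       -- Σ aᵢ ∧(σᵢ) = 0 in Λ  iff  Σ aᵢ c̄(σᵢ) = 0 in H̃^{n-2}((0̂,[n]^μ))
       ((L : List (Carrier × Word n)) → All (λ p → IsColPerm n μ (proj₂ p)) L →
          InI L ⇔ InImδ n μ (map (λ p → proj₁ p , cbar μ (proj₂ p)) L))
       -- φ is surjective: every maximal chain class is in the image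
       × ((d : Chain n μ) → IsMaxChainOI n μ d →
          ∃ λ (L : List (Carrier × Word n)) → All (λ p → IsColPerm n μ (proj₂ p)) L
            × InImδ n μ ((1# , d) ∷ map (λ p → - proj₁ p , cbar μ (proj₂ p)) L))
       -- φ is 𝔖_n-equivariant: φ(τ·∧(σ)) = τ·φ(∧(σ))
       × ((τ : Permutation′ n) (σ : Word n) → IsColPerm n μ σ →
          IsColPerm n μ (actWord τ σ)
          × cbar μ (actWord τ σ) ≡ map (actVertex τ) (cbar μ σ))
theorem2p1 K _ n μ s =
  (λ L cps → mk⇔ (InI⇒InImδ L cps) (InImδ⇒InI L cps)) ,
  surjective ,
  λ π σ cp → IsColPerm-act μ π σ cp , cbar-act μ π σ
  where
  open Cochains.Isomorphism K n μ s
  open Combinatorics.Action using (IsColPerm-act; cbar-act)
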